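{- Let $k \ge 2$ and let $H$ be a $k$-uniform hypergraph with vertex set $V$, $n=|V|$, $m=|E(H)|$ edges and edge density $d = m/\binom{n}{k}$. If $t = t(n,d,k) \ge 2$, then the algorithm $\mathrm{FindPartite}(H,k)$ described below returns a tuple $(V_1,\dots,V_k)$ of pairwise disjoint sets $V_i \subseteq V$ such that $|V_i| \ge t$ for all $i$ and $H[V_1,\dots,V_k]$ is complete, i.e. every set $\{x_1,\dots,x_k\}$ with $x_i\in V_i$ for all $i$ is an edge of $H$.
   Context: Logarithms are natural. For a $j$-uniform hypergraph with $n$ vertices and edge density $d$ (number of edges divided by $\binom{n}{j}$), define $t(n,d,j) = \lfloor (\log n / \log(16/d))^{1/(j-1)} \rfloor$, $w(n,d,j) = \lceil 4t/d \rceil$ and $s(n,d,j) = \lceil (d/4)^{t}\binom{n}{j-1} \rceil$ with $t = t(n,d,j)$. The algorithm $\mathrm{FindPartite}(H,j)$, on input a $j$-uniform hypergraph $H$ with vertex set $V$, works as follows. If $j=1$, it returns the 1-tuple $(\{x : \{x\}\in E(H)\})$. Otherwise it computes $n=|V|$, $m=|E(H)|$, $d = m/\binom{n}{j}$, and $t=t(n,d,j)$, $w=w(n,d,j)$, $s=s(n,d,j)$; it lets $W$ be a set of $w$ vertices of highest degree in $H$ (ties broken arbitrarily). It then iterates over all subsets $T\subseteq W$ with $|T|=t$; for each such $T$ it forms $S = \{y \in \binom{V}{j-1} : \{x\}\cup y \in E(H) \text{ for all } x\in T\}$, and if $|S|\ge s$ it forms the $(j-1)$-uniform hypergraph $H'=(V,S)$,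 computes $(V_1,\dots,V_{j-1}) = \mathrm{FindPartite}(H',j-1)$ recursively, and returns $(V_1,\dots,V_{j-1},T)$ (stopping the iteration). -}

module Defs where

open import Data.Bool using (Bool; true; false; _∧_; _∨_; not; if_then_else_)
open import Data.Nat using (ℕ; zero; suc; _+_; _*_; _∸_; _^_; _≤_; _<_; _≤ᵇ_; _<ᵇ_; _⊓_)
open import Data.Nat.DivMod using (_/_)
open import Data.Nat.Combinatorics using (_C_)
open import Data.Fin using (Fin; _≟_)
open import Data.Fin.Subset using (Subset; ⁅_⁆; _∪_; ∣_∣; _∈_; _∉_; _⊆_)
open import Data.List using (List; []; _∷_; map; _++_; length; filterᵇ; allFin)
open import Data.Bool.ListAction using (all; any)
open import Data.Vec using (Vec; []; _∷_; lookup; tabulate; _∷ʳ_)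
open import Data.Product using (Σ; _×_)
open import Data.Unit using (⊤)
open import Data.Empty using (⊥)
open import Relation.Binary.PropositionalEquality using (_≡_; _≢_)
open import Relation.Nullary.Decidable using (⌊_⌋)

Hyp : ℕ → Set
Hyp n = Subset n → Bool

Uniform : ∀ {n} → ℕ → Hyp n → Set
Uniform j E = ∀ s → E s ≡ true → ∣ s ∣ ≡ j

allSubsets : (n : ℕ) → List (Subset n)
allSubsets zero = [] ∷ []
allSubsets (suc n) = map (false ∷_) (allSubsets n) ++ map (true ∷_) (allSubsets n)

count : ∀ {A : Set} → (A → Bool) → List A → ℕ
count p xs = length (filterᵇ p xs)

edges : ∀ {n} → Hyp n → ℕ
edges {n} E = count E (allSubsets n)

deg : ∀ {n} → Hyp n → Fin n → ℕ
deg {n} E x = count (λ s → E s ∧ lookup s x) (allSubsets n)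

-- ceiling division (b = 0 gives 0 by convention; never relevant)
ceilDiv : ℕ → ℕ → ℕ
ceilDiv a zero = 0
ceilDiv a (suc b) = (a + b) / suc b

-- With d = m / C(n,j), the condition  t ≤ (log n / log(16/d))^{1/(j-1)}
-- is equivalent (for 0 < m, j ≥ 2) to  (16/d)^{t^{j-1}} ≤ n,
-- i.e.  (16 * C(n,j))^{t^{j-1}} ≤ n * m^{t^{j-1}}.
tCond : (n m j t : ℕ) → Bool
tCond n m j t = (0 <ᵇ m) ∧ (((16 * (n C j)) ^ (t ^ (j ∸ 1))) ≤ᵇ (n * (m ^ (t ^ (j ∸ 1)))))

tSearch : (n m j bound : ℕ) → ℕ
tSearch n m j zero = 0
tSearch n m j (suc b) = if tCond n m j (suc b) then suc b else tSearch n m j b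

-- t(n,d,j) = ⌊ (log n / log(16/d))^{1/(j-1)} ⌋  with d = m / C(n,j);
-- any admissible t satisfies 16^t ≤ n, so t ≤ n and searching up to n suffices.
tval : (n m j : ℕ) → ℕ
tval n m j = tSearch n m j n

-- w(n,d,j) = ⌈ 4t/d ⌉ = ⌈ 4 t C(n,j) / m ⌉
wval : (n m j : ℕ) → ℕ
wval n m j = ceilDiv (4 * tval n m j * (n C j)) m

-- s(n,d,j) = ⌈ (d/4)^t C(n,j-1) ⌉ = ⌈ m^t C(n,j-1) / (4^t C(n,j)^t) ⌉
sval : (n m j : ℕ) → ℕ
sval n m j = ceilDiv ((m ^ t) * (n C (j ∸ 1))) ((4 ^ t) * ((n C j) ^ t))
  where t = tval n m j

-- W is a set of w vertices of highest degree (ties arbitrary);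
-- if w > n we take |W| = n (i.e. W = V).
AdmW : ∀ {n} → ℕ → Hyp n → Subset n → Set
AdmW {n} j E W =
  (∣ W ∣ ≡ wval n (edges E) j ⊓ n) ×
  (∀ x y → x ∈ W → y ∉ W → deg E y ≤ deg E x)

-- S = { y ∈ (V choose j-1) : {x} ∪ y ∈ E(H) for all x ∈ T }, as the
-- edge predicate of the (j-1)-uniform hypergraph H' = (V, S)
Slink : ∀ {n} → ℕ → Hyp n → Subset n → Hyp n
Slink {n} j E T y =
  ⌊ ∣ y ∣ Data.Nat.≟ (j ∸ 1) ⌋ ∧ all (λ x → not (lookup T x) ∨ E (⁅ x ⁆ ∪ y)) (allFin n)

Chosen : ∀ {n} → ℕ → Hyp n → Subset n → Subset n → Set
Chosen {n} j E W T =
  (T ⊆ W) × (∣ T ∣ ≡ tval n (edges E) j) × (sval n (edges E) j ≤ edges (Slink j E T))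

-- Possible outputs of FindPartite(H, j) (nondeterminism: choice of W among
-- ties, and order of iteration over the subsets T).
data Run {n : ℕ} : (j : ℕ) → Hyp n → Vec (Subset n) j → Set where
  base : ∀ {E} → Run 1 E (tabulate (λ x → E ⁅ x ⁆) ∷ [])
  step : ∀ {j E W T out} → AdmW (suc (suc j)) E W → Chosen (suc (suc j)) E W T →
         Run (suc j) (Slink (suc (suc j)) E T) out →
         Run (suc (suc j)) E (out ∷ʳ T)

-- Every execution of FindPartite(H, j) succeeds (returns a tuple): for every
-- admissible W some T passes the test, and every recursive call on a
-- passing T succeeds in turn.
Succeeds : ∀ {n} → (j : ℕ) → Hyp n → Set
Succeeds zero E = ⊥
Succeeds (suc zero) E = ⊤
Succeeds {n} (suc (suc j)) E =
  (∀ W → AdmW (suc (suc j)) E W → Σ (Subset n) (λ T → Chosen (suc (suc j)) E W T)) ×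
  (∀ W T → AdmW (suc (suc j)) E W → Chosen (suc (suc j)) E W T →
     Succeeds (suc j) (Slink (suc (suc j)) E T))

image : ∀ {n k} → (Fin k → Fin n) → Subset n
image {n} {k} f = tabulate (λ x → any (λ i → ⌊ f i ≟ x ⌋) (allFin k))

GoodPartite : ∀ {n k} → Hyp n → ℕ → Vec (Subset n) k → Set
GoodPartite {n} {k} E t Vs =
  (∀ i j → i ≢ j → ∀ x → x ∈ lookup Vs i → x ∈ lookup Vs j → ⊥) ×
  (∀ i → t ≤ ∣ lookup Vs i ∣) ×
  (∀ (f : Fin k → Fin n) → (∀ i → f i ∈ lookup Vs i) → E (image f) ≡ true)

-- With m edges, t = t(n,d,j) ≥ 2 means (16/d)^(t^(j-1)) ≤ n, which makes n large
-- (n ≥ 2(j-1), n ≥ t, n ≥ 4t/d). Counting pairs (T, y) with T a t-subset of W and y ∈ S_T gives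
-- Σ_T |S_T| = Σ_y C(a_y, t), where a_y = |{x ∈ W : {x} ∪ y ∈ E}| ranges over (j-1)-sets y.
-- Since W holds the w top-degree vertices, the mean of a_y is at least about |W| j m / (n C(n,j-1)),
-- and with |W| ≥ 4t/d convexity of a ↦ C(a,t) gives some T with |S_T| ≥ (d/4)^t C(n,j-1) = s.
-- The link H' = (V, S_T) then has density d' ≥ (d/4)^t, so (16/d')^(t^(j-2)) ≤ (16/d)^(t^(j-1)) ≤ n
-- and t ≤ t(n,d',j-1): the recursion succeeds with parts of size ≥ t. The vertices of T lie on no
-- edge of H', as {x} ∪ y = y would be an edge of H of size j-1, so T is disjoint from the other
-- parts; every transversal is {x} ∪ y with x ∈ T and y ∈ S_T, hence an edge.

module Submission where

open import Defs
open import Data.Bool using (Bool; true; false; _∧_; _∨_; not)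
import Data.Bool as Bool
open import Data.Bool.Properties using (∧-zeroʳ; ∧-comm; ∧-identityʳ)
open import Data.Bool.ListAction using (all; and)
open import Data.Empty using (⊥)
open import Data.Unit using (tt)
open import Data.Nat
open import Data.Nat.Properties
open import Data.Nat.DivMod using (_/_; _%_; m/n*n≤m; m≡m%n+[m/n]*n; m%n<n; m<n*o⇒m/o<n)
open import Data.Nat.Combinatorics using (_C_; nCk+nC[k+1]≡[n+1]C[k+1])
open import Data.Nat.Tactic.RingSolver using (solve-∀)
open import Algebra.Properties.Semiring.Sum Data.Nat.Properties.+-*-semiring
  using (sum; sum-syntax; sum-cong-≗; ∑-distrib-+; ∑-comm; *-distribˡ-sum; *-distribʳ-sum)
open import Data.Fin using (Fin; zero; suc; inject₁; fromℕ)
open import Data.Fin.Properties using () renaming (_≟_ to _≟ᶠ_)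
open import Data.Fin.Subset using (Subset; ⁅_⁆; _∪_; _∩_; ∣_∣; _∈_; _∉_; _⊆_; Nonempty) renaming (⊥ to ∅)
open import Data.Fin.Subset.Properties
  using (∪-identityˡ; ∪-identityʳ; ⊆-antisym; x∈p∪q⁺; x∈p∪q⁻; q⊆p∪q; x∈⁅x⁆; x∈⁅y⁆⇒x≡y; nonempty?; Empty-unique; ∣⊥∣≡0)
open import Data.List using ([]; _∷_; map; _++_; length; filterᵇ; allFin)
open import Data.List.Properties using (length-++; filter-++; map-tabulate)
open import Data.List.Relation.Unary.Any.Properties using (any⁺; any⁻; tabulate⁺; tabulate⁻)
open import Data.Vec using (Vec; []; _∷_; lookup; tabulate; _∷ʳ_)
open import Data.Vec.Properties using (lookup-zipWith; lookup∘tabulate; []=⇒lookup; lookup⇒[]=)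
open import Data.Product using (Σ; ∃-syntax; _×_; _,_; proj₁; proj₂)
open import Data.Sum using (_⊎_; inj₁; inj₂)
open import Function using (_∘_; id)
open import Relation.Binary using (_Preserves_⟶_)
open import Relation.Binary.PropositionalEquality
open import Relation.Nullary.Decidable using (T?; ⌊_⌋; Dec; does; _because_; yes; no; fromWitness; toWitness)
open import Relation.Nullary.Negation using (contradiction)

⟦_⟧ : Bool → ℕ
⟦ true ⟧ = 1
⟦ false ⟧ = 0

⟦∧⟧ : ∀ a b → ⟦ a ∧ b ⟧ ≡ ⟦ a ⟧ * ⟦ b ⟧
⟦∧⟧ true b = sym (+-identityʳ ⟦ b ⟧)
⟦∧⟧ false b = refl

0<⟦b⟧*k⇒b≡true : ∀ b k → 0 < ⟦ b ⟧ * k → b ≡ true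
0<⟦b⟧*k⇒b≡true true k _ = refl

≡true⇒T : ∀ {b} → b ≡ true → Bool.T b
≡true⇒T refl = tt

T⇒≡true : ∀ {b} → Bool.T b → b ≡ true
T⇒≡true {true} _ = refl

∧-true-left : ∀ a b → a ∧ b ≡ true → a ≡ true
∧-true-left true b _ = refl

∧-true-right : ∀ a b → a ∧ b ≡ true → b ≡ true
∧-true-right true b eq = eq

⌊≟⌋≡≡ᵇ : ∀ a b → ⌊ a ≟ b ⌋ ≡ (a ≡ᵇ b)
⌊≟⌋≡≡ᵇ a b = ⌊⌋≡does (a ≟ b)
  where
  ⌊⌋≡does : ∀ {A : Set} (d : Dec A) → ⌊ d ⌋ ≡ does d
  ⌊⌋≡does (true because _) = refl
  ⌊⌋≡does (false because _) = refl

≡ᵇ-refl : ∀ a → (a ≡ᵇ a) ≡ true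
≡ᵇ-refl zero = refl
≡ᵇ-refl (suc a) = ≡ᵇ-refl a

≡ᵇ-sound : ∀ a b → (a ≡ᵇ b) ≡ true → a ≡ b
≡ᵇ-sound a b eq = ≡ᵇ⇒≡ a b (≡true⇒T eq)

0<^ : ∀ {m} k → 0 < m → 0 < m ^ k
0<^ {m} k m>0 = m^n>0 m {{>-nonZero m>0}} k

0<m*n⇒0<m : ∀ {m n} → 0 < m * n → 0 < m
0<m*n⇒0<m {suc m} _ = s≤s z≤n

[m*n]^k≡m^k*n^k : ∀ m n k → (m * n) ^ k ≡ m ^ k * n ^ k
[m*n]^k≡m^k*n^k m n zero = refl
[m*n]^k≡m^k*n^k m n (suc k) = trans (cong (m * n *_) ([m*n]^k≡m^k*n^k m n k)) (interchange m n (m ^ k) (n ^ k))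
  where
  interchange : ∀ a b c d → a * b * (c * d) ≡ a * c * (b * d)
  interchange = solve-∀

m≤n*[1+m/n] : ∀ m n .{{_ : NonZero n}} → m ≤ n * suc (m / n)
m≤n*[1+m/n] m n@(suc n-1) = begin
  m                          ≡⟨ m≡m%n+[m/n]*n m n ⟩
  m % n + m / n * n          ≤⟨ +-monoˡ-≤ (m / n * n) (<⇒≤ (m%n<n m n)) ⟩
  suc (m / n) * n            ≡⟨ *-comm (suc (m / n)) n ⟩
  n * suc (m / n)            ∎
  where open ≤-Reasoning

a≤ceilDiv[a,b]*b : ∀ a b → 0 < b → a ≤ ceilDiv a b * b
a≤ceilDiv[a,b]*b a (suc b) _ = +-cancelʳ-≤ b a _ (begin
  a + b                                      ≡⟨ m≡m%n+[m/n]*n (a + b) (suc b) ⟩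
  (a + b) % suc b + (a + b) / suc b * suc b  ≤⟨ +-monoˡ-≤ _ (<⇒≤pred (m%n<n (a + b) (suc b))) ⟩
  b + (a + b) / suc b * suc b                ≡⟨ +-comm b _ ⟩
  (a + b) / suc b * suc b + b                ∎)
  where open ≤-Reasoning

ceilDiv-least : ∀ a b k → 0 < b → a ≤ k * b → ceilDiv a b ≤ k
ceilDiv-least a (suc b) k _ a≤k*b = <⇒≤pred (m<n*o⇒m/o<n (s≤s (begin
  a + b              ≤⟨ +-monoˡ-≤ b a≤k*b ⟩
  k * suc b + b      ≡⟨ +-comm (k * suc b) b ⟩
  suc k * suc b ∸ 1  ∎)))
  where open ≤-Reasoning

x+[y+z]≡[x+z]+y : ∀ x y z → x + (y + z) ≡ (x + z) + y
x+[y+z]≡[x+z]+y = solve-∀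

n≤2^n : ∀ n → n ≤ 2 ^ n
n≤2^n zero = z≤n
n≤2^n (suc n) = +-mono-≤ (0<^ n (s≤s z≤n)) (≤-trans (n≤2^n n) (m≤m+n (2 ^ n) 0))

4*n≤16^n : ∀ n → 4 * n ≤ 16 ^ n
4*n≤16^n zero = z≤n
4*n≤16^n (suc n) = begin
  4 * suc n           ≡⟨ *-suc 4 n ⟩
  4 + 4 * n           ≤⟨ +-mono-≤ (*-monoʳ-≤ 4 (0<^ n (s≤s z≤n))) (≤-trans (4*n≤16^n n) (m≤n*m (16 ^ n) 12)) ⟩
  4 * 16 ^ n + 12 * 16 ^ n ≡⟨ sym (*-distribʳ-+ (16 ^ n) 4 12) ⟩
  16 * 16 ^ n         ∎
  where open ≤-Reasoning

-- Sums over subsets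

sumˢ : ∀ {n} → (Subset n → ℕ) → ℕ
sumˢ {zero} f = f []
sumˢ {suc n} f = sumˢ (f ∘ (false ∷_)) + sumˢ (f ∘ (true ∷_))

infixl 10 sumˢ
syntax sumˢ (λ s → e) = ∑ˢ[ s ] e

sumˢ-cong : ∀ {n} {f g : Subset n → ℕ} → (∀ s → f s ≡ g s) → sumˢ f ≡ sumˢ g
sumˢ-cong {zero} f≗g = f≗g []
sumˢ-cong {suc n} f≗g = cong₂ _+_ (sumˢ-cong (f≗g ∘ (false ∷_))) (sumˢ-cong (f≗g ∘ (true ∷_)))

sumˢ-mono-≤ : ∀ {n} {f g : Subset n → ℕ} → (∀ s → f s ≤ g s) → sumˢ f ≤ sumˢ g
sumˢ-mono-≤ {zero} f≤g = f≤g []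
sumˢ-mono-≤ {suc n} f≤g = +-mono-≤ (sumˢ-mono-≤ (f≤g ∘ (false ∷_))) (sumˢ-mono-≤ (f≤g ∘ (true ∷_)))

sumˢ-zero : ∀ n → sumˢ {n} (λ _ → 0) ≡ 0
sumˢ-zero zero = refl
sumˢ-zero (suc n) = cong₂ _+_ (sumˢ-zero n) (sumˢ-zero n)

sumˢ-distrib-+ : ∀ {n} (f g : Subset n → ℕ) → ∑ˢ[ s ] (f s + g s) ≡ sumˢ f + sumˢ g
sumˢ-distrib-+ {zero} f g = refl
sumˢ-distrib-+ {suc n} f g = begin
  ∑ˢ[ s ] (f (false ∷ s) + g (false ∷ s)) + ∑ˢ[ s ] (f (true ∷ s) + g (true ∷ s))
    ≡⟨ cong₂ _+_ (sumˢ-distrib-+ (f ∘ (false ∷_)) (g ∘ (false ∷_))) (sumˢ-distrib-+ (f ∘ (true ∷_)) (g ∘ (true ∷_))) ⟩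
  (sumˢ (f ∘ (false ∷_)) + sumˢ (g ∘ (false ∷_))) + (sumˢ (f ∘ (true ∷_)) + sumˢ (g ∘ (true ∷_)))
    ≡⟨ +-comm-middle (sumˢ (f ∘ (false ∷_))) (sumˢ (g ∘ (false ∷_))) _ _ ⟩
  sumˢ f + sumˢ g ∎
  where
  open ≡-Reasoning
  +-comm-middle : ∀ a b c d → (a + b) + (c + d) ≡ (a + c) + (b + d)
  +-comm-middle = solve-∀

*-distribˡ-sumˢ : ∀ {n} c (f : Subset n → ℕ) → ∑ˢ[ s ] (c * f s) ≡ c * sumˢ f
*-distribˡ-sumˢ {zero} c f = refl
*-distribˡ-sumˢ {suc n} c f =
  trans (cong₂ _+_ (*-distribˡ-sumˢ c (f ∘ (false ∷_))) (*-distribˡ-sumˢ c (f ∘ (true ∷_)))) (sym (*-distribˡ-+ c _ _))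

*-distribʳ-sumˢ : ∀ {n} c (f : Subset n → ℕ) → ∑ˢ[ s ] (f s * c) ≡ sumˢ f * c
*-distribʳ-sumˢ c f = trans (sumˢ-cong (λ s → *-comm (f s) c)) (trans (*-distribˡ-sumˢ c f) (*-comm c (sumˢ f)))

sumˢ-comm : ∀ {m n} (f : Subset m → Subset n → ℕ) → ∑ˢ[ s ] ∑ˢ[ s' ] f s s' ≡ ∑ˢ[ s' ] ∑ˢ[ s ] f s s'
sumˢ-comm {zero} f = refl
sumˢ-comm {suc m} {n} f = trans (cong₂ _+_ (sumˢ-comm (f ∘ (false ∷_))) (sumˢ-comm (f ∘ (true ∷_))))
  (sym (sumˢ-distrib-+ (λ s' → sumˢ {m} (λ s → f (false ∷ s) s')) _))

∑-sumˢ-comm : ∀ {m n} (f : Fin m → Subset n → ℕ) → ∑[ x < m ] sumˢ (f x) ≡ ∑ˢ[ s ] ∑[ x < m ] f x s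
∑-sumˢ-comm {zero} {n} f = sym (sumˢ-zero n)
∑-sumˢ-comm {suc m} f = trans (cong (sumˢ (f zero) +_) (∑-sumˢ-comm (f ∘ suc))) (sym (sumˢ-distrib-+ (f zero) _))

∑-mono-≤ : ∀ {n} {f g : Fin n → ℕ} → (∀ x → f x ≤ g x) → sum f ≤ sum g
∑-mono-≤ {zero} f≤g = z≤n
∑-mono-≤ {suc n} f≤g = +-mono-≤ (f≤g zero) (∑-mono-≤ (f≤g ∘ suc))

larger : ∀ {A : Set} → (A → ℕ) → A → A → A
larger f a b with f a ≤? f b
... | yes _ = b
... | no _ = a

larger-≥ˡ : ∀ {A : Set} (f : A → ℕ) a b → f a ≤ f (larger f a b)
larger-≥ˡ f a b with f a ≤? f b
... | yes fa≤fb = fa≤fb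
... | no _ = ≤-refl

larger-≥ʳ : ∀ {A : Set} (f : A → ℕ) a b → f b ≤ f (larger f a b)
larger-≥ʳ f a b with f a ≤? f b
... | yes _ = ≤-refl
... | no fa≰fb = <⇒≤ (≰⇒> fa≰fb)

argmaxˢ : ∀ {n} → (Subset n → ℕ) → Subset n
argmaxˢ {zero} f = []
argmaxˢ {suc n} f = larger f (false ∷ argmaxˢ (f ∘ (false ∷_))) (true ∷ argmaxˢ (f ∘ (true ∷_)))

≤-argmaxˢ : ∀ {n} (f : Subset n → ℕ) s → f s ≤ f (argmaxˢ f)
≤-argmaxˢ f [] = ≤-refl
≤-argmaxˢ f (false ∷ s) = ≤-trans (≤-argmaxˢ (f ∘ (false ∷_)) s) (larger-≥ˡ f _ _)
≤-argmaxˢ f (true ∷ s) = ≤-trans (≤-argmaxˢ (f ∘ (true ∷_)) s) (larger-≥ʳ f _ _)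

sumˢ-≤-count*max : ∀ {n} (p : Subset n → Bool) (f : Subset n → ℕ) →
  ∃[ s ] (∑ˢ[ s' ] (⟦ p s' ⟧ * f s') ≤ ∑ˢ[ s' ] ⟦ p s' ⟧ * (⟦ p s ⟧ * f s))
sumˢ-≤-count*max {n} p f = s* , (begin
  ∑ˢ[ s ] g s                    ≤⟨ sumˢ-mono-≤ bounded ⟩
  ∑ˢ[ s ] (⟦ p s ⟧ * g s*)       ≡⟨ *-distribʳ-sumˢ (g s*) (⟦_⟧ ∘ p) ⟩
  ∑ˢ[ s ] ⟦ p s ⟧ * g s*         ∎)
  where
  open ≤-Reasoning
  g : Subset n → ℕ
  g s = ⟦ p s ⟧ * f s
  s* : Subset n
  s* = argmaxˢ g
  bounded : ∀ s → g s ≤ ⟦ p s ⟧ * g s*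
  bounded s = by-cases (p s) refl
    where
    by-cases : ∀ b → p s ≡ b → g s ≤ ⟦ b ⟧ * g s*
    by-cases true _ = ≤-trans (≤-argmaxˢ g s) (≤-reflexive (sym (+-identityʳ (g s*))))
    by-cases false ps = ≤-reflexive (cong (λ b → ⟦ b ⟧ * f s) ps)

count-++ : ∀ {A : Set} (p : A → Bool) xs ys → count p (xs ++ ys) ≡ count p xs + count p ys
count-++ p xs ys = trans (cong length (filter-++ (T? ∘ p) xs ys)) (length-++ (filterᵇ p xs))

count-map : ∀ {A B : Set} (p : B → Bool) (g : A → B) xs → count p (map g xs) ≡ count (p ∘ g) xs
count-map p g [] = refl
count-map p g (x ∷ xs) with p (g x)
... | true = cong suc (count-map p g xs)
... | false = count-map p g xs

count-allSubsets : ∀ n (p : Subset n → Bool) → count p (allSubsets n) ≡ ∑ˢ[ s ] ⟦ p s ⟧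
count-allSubsets zero p with p []
... | true = refl
... | false = refl
count-allSubsets (suc n) p = begin
  count p (map (false ∷_) (allSubsets n) ++ map (true ∷_) (allSubsets n))
    ≡⟨ count-++ p (map (false ∷_) (allSubsets n)) _ ⟩
  count p (map (false ∷_) (allSubsets n)) + count p (map (true ∷_) (allSubsets n))
    ≡⟨ cong₂ _+_ (count-map p (false ∷_) (allSubsets n)) (count-map p (true ∷_) (allSubsets n)) ⟩
  count (p ∘ (false ∷_)) (allSubsets n) + count (p ∘ (true ∷_)) (allSubsets n)
    ≡⟨ cong₂ _+_ (count-allSubsets n _) (count-allSubsets n _) ⟩
  ∑ˢ[ s ] ⟦ p s ⟧ ∎
  where open ≡-Reasoning

∣∣≡∑ : ∀ {n} (s : Subset n) → ∣ s ∣ ≡ ∑[ x < n ] ⟦ lookup s x ⟧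
∣∣≡∑ [] = refl
∣∣≡∑ (true ∷ s) = cong suc (∣∣≡∑ s)
∣∣≡∑ (false ∷ s) = ∣∣≡∑ s

-- Binomial coefficients

_choose_ : ℕ → ℕ → ℕ
n choose zero = 1
zero choose suc k = 0
suc n choose suc k = n choose k + n choose suc k

C≡choose : ∀ n k → n C k ≡ n choose k
C≡choose n zero = refl
C≡choose zero (suc k) = refl
C≡choose (suc n) (suc k) =
  trans (sym (nCk+nC[k+1]≡[n+1]C[k+1] n k)) (cong₂ _+_ (C≡choose n k) (C≡choose n (suc k)))

choose-≤-suc : ∀ n k → n choose k ≤ suc n choose k
choose-≤-suc n zero = ≤-refl
choose-≤-suc n (suc k) = m≤n+m (n choose suc k) (n choose k)

choose-monoˡ-≤ : ∀ k → (_choose k) Preserves _≤_ ⟶ _≤_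
choose-monoˡ-≤ k {n} n≤n' with m≤n⇒∃[o]m+o≡n n≤n'
... | o , refl = go o
  where
  go : ∀ o → n choose k ≤ (n + o) choose k
  go zero = ≤-reflexive (cong (_choose k) (sym (+-identityʳ n)))
  go (suc o) = ≤-trans (go o) (subst (λ z → (n + o) choose k ≤ z choose k) (sym (+-suc n o)) (choose-≤-suc (n + o) k))

0<choose : ∀ {n k} → k ≤ n → 0 < n choose k
0<choose {n} {zero} _ = s≤s z≤n
0<choose {suc n} {suc k} (s≤s k≤n) = ≤-trans (0<choose k≤n) (m≤m+n (n choose k) (n choose suc k))

choose-1 : ∀ n → n choose 1 ≡ n
choose-1 zero = refl
choose-1 (suc n) = cong suc (choose-1 n)

choose-absorb : ∀ n k → suc k * (suc n choose suc k) ≡ suc n * (n choose k)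
choose-absorb zero zero = refl
choose-absorb zero (suc k) = *-zeroʳ (suc (suc k))
choose-absorb (suc n) zero = trans (+-identityʳ _) (trans (choose-1 (suc (suc n))) (sym (*-identityʳ (suc (suc n)))))
choose-absorb (suc n) (suc k) = begin
  suc (suc k) * (suc n choose suc k + suc n choose suc (suc k))
    ≡⟨ *-distribˡ-+ (suc (suc k)) (suc n choose suc k) _ ⟩
  suc (suc k) * (suc n choose suc k) + suc (suc k) * (suc n choose suc (suc k))
    ≡⟨ cong₂ (λ a b → suc n choose suc k + a + b) (choose-absorb n k) (choose-absorb n (suc k)) ⟩
  suc n choose suc k + suc n * (n choose k) + suc n * (n choose suc k)
    ≡⟨ +-assoc (suc n choose suc k) _ _ ⟩
  suc n choose suc k + (suc n * (n choose k) + suc n * (n choose suc k))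
    ≡⟨ cong (suc n choose suc k +_) (sym (*-distribˡ-+ (suc n) (n choose k) _)) ⟩
  suc n choose suc k + suc n * (suc n choose suc k) ∎
  where open ≡-Reasoning

[1+k]*nC[1+k]+k*nCk≡n*nCk : ∀ n k → suc k * (n choose suc k) + k * (n choose k) ≡ n * (n choose k)
[1+k]*nC[1+k]+k*nCk≡n*nCk zero zero = refl
[1+k]*nC[1+k]+k*nCk≡n*nCk zero (suc k) = cong₂ _+_ (*-zeroʳ (suc (suc k))) (*-zeroʳ (suc k))
[1+k]*nC[1+k]+k*nCk≡n*nCk (suc n) zero = trans (+-identityʳ _) (choose-absorb n 0)
[1+k]*nC[1+k]+k*nCk≡n*nCk (suc n) (suc k) = begin
  suc (suc k) * (suc n choose suc (suc k)) + suc k * (suc n choose suc k)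
    ≡⟨ cong₂ _+_ (choose-absorb n (suc k)) (choose-absorb n k) ⟩
  suc n * (n choose suc k) + suc n * (n choose k)
    ≡⟨ sym (*-distribˡ-+ (suc n) (n choose suc k) (n choose k)) ⟩
  suc n * (n choose suc k + n choose k)
    ≡⟨ cong (suc n *_) (+-comm (n choose suc k) (n choose k)) ⟩
  suc n * (suc n choose suc k) ∎
  where open ≡-Reasoning

n*nC[1+r]≤2*[2+r]*nC[2+r] : ∀ n r → 2 * suc r ≤ n → n * (n choose suc r) ≤ 2 * (2 + r) * (n choose (2 + r))
n*nC[1+r]≤2*[2+r]*nC[2+r] n r 2[1+r]≤n = +-cancelʳ-≤ (n * N₁) _ _ (begin
  n * N₁ + n * N₁
    ≡⟨ cong (λ z → z + z) (sym ([1+k]*nC[1+k]+k*nCk≡n*nCk n (suc r))) ⟩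
  ((2 + r) * N₂ + suc r * N₁) + ((2 + r) * N₂ + suc r * N₁)
    ≡⟨ double r N₂ N₁ ⟩
  2 * (2 + r) * N₂ + 2 * suc r * N₁
    ≤⟨ +-monoʳ-≤ (2 * (2 + r) * N₂) (*-monoˡ-≤ N₁ 2[1+r]≤n) ⟩
  2 * (2 + r) * N₂ + n * N₁ ∎)
  where
  open ≤-Reasoning
  N₁ : ℕ
  N₁ = n choose suc r
  N₂ : ℕ
  N₂ = n choose (2 + r)
  double : ∀ r a b → ((2 + r) * a + suc r * b) + ((2 + r) * a + suc r * b) ≡ 2 * (2 + r) * a + 2 * suc r * b
  double = solve-∀

_falling_ : ℕ → ℕ → ℕ
q falling zero = 1
q falling suc t = q * (pred q falling t)

falling≡choose*! : ∀ q t → q falling t ≡ (q choose t) * t !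
falling≡choose*! q zero = refl
falling≡choose*! zero (suc t) = refl
falling≡choose*! (suc q) (suc t) = begin
  suc q * (q falling t)                   ≡⟨ cong (suc q *_) (falling≡choose*! q t) ⟩
  suc q * ((q choose t) * t !)            ≡⟨ sym (*-assoc (suc q) (q choose t) (t !)) ⟩
  suc q * (q choose t) * t !              ≡⟨ cong (_* t !) (sym (choose-absorb q t)) ⟩
  suc t * (suc q choose suc t) * t !      ≡⟨ cong (_* t !) (*-comm (suc t) (suc q choose suc t)) ⟩
  (suc q choose suc t) * suc t * t !      ≡⟨ *-assoc (suc q choose suc t) (suc t) (t !) ⟩
  (suc q choose suc t) * (suc t * t !)    ∎
  where open ≡-Reasoning

[1+q∸t]^t≤falling : ∀ q t → (suc q ∸ t) ^ t ≤ q falling t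
[1+q∸t]^t≤falling q zero = ≤-refl
[1+q∸t]^t≤falling zero (suc t) = ≤-reflexive (cong (_^ suc t) (0∸n≡0 t))
[1+q∸t]^t≤falling (suc q) (suc t) = *-mono-≤ (m∸n≤m (suc q) t) ([1+q∸t]^t≤falling q t)

falling≤^ : ∀ q t → q falling t ≤ q ^ t
falling≤^ q zero = ≤-refl
falling≤^ q (suc t) = *-monoʳ-≤ q (≤-trans (falling≤^ (pred q) t) (^-monoˡ-≤ t pred[n]≤n))

choose*^≤choose*^ : ∀ q w m D t → w * m ≤ D * (suc q ∸ t) → (w choose t) * m ^ t ≤ (q choose t) * D ^ t
choose*^≤choose*^ q w m D t wm≤D[1+q-t] = *-cancelʳ-≤ _ _ (t !) {{t !≢0}} (begin
  (w choose t) * m ^ t * t !     ≡⟨ *-right-comm (w choose t) (m ^ t) (t !) ⟩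
  (w choose t) * t ! * m ^ t     ≡⟨ cong (_* m ^ t) (sym (falling≡choose*! w t)) ⟩
  w falling t * m ^ t            ≤⟨ *-monoˡ-≤ (m ^ t) (falling≤^ w t) ⟩
  w ^ t * m ^ t                  ≡⟨ sym ([m*n]^k≡m^k*n^k w m t) ⟩
  (w * m) ^ t                    ≤⟨ ^-monoˡ-≤ t wm≤D[1+q-t] ⟩
  (D * (suc q ∸ t)) ^ t          ≡⟨ [m*n]^k≡m^k*n^k D (suc q ∸ t) t ⟩
  D ^ t * (suc q ∸ t) ^ t        ≤⟨ *-monoʳ-≤ (D ^ t) ([1+q∸t]^t≤falling q t) ⟩
  D ^ t * q falling t            ≡⟨ cong (D ^ t *_) (falling≡choose*! q t) ⟩
  D ^ t * ((q choose t) * t !)   ≡⟨ x*[y*z]≡y*x*z (D ^ t) (q choose t) (t !) ⟩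
  (q choose t) * D ^ t * t !     ∎)
  where
  open ≤-Reasoning
  *-right-comm : ∀ x y z → x * y * z ≡ x * z * y
  *-right-comm = solve-∀
  x*[y*z]≡y*x*z : ∀ x y z → x * (y * z) ≡ y * x * z
  x*[y*z]≡y*x*z = solve-∀

choose-growth-≥ : ∀ q r u → q choose suc u + r * (q choose u) ≤ (q + r) choose suc u
choose-growth-≥ q zero u = ≤-reflexive (trans (+-identityʳ _) (cong (_choose suc u) (sym (+-identityʳ q))))
choose-growth-≥ q (suc r) u = begin
  q choose suc u + (q choose u + r * (q choose u))
    ≡⟨ x+[y+z]≡[x+z]+y (q choose suc u) (q choose u) _ ⟩
  (q choose suc u + r * (q choose u)) + q choose u
    ≤⟨ +-mono-≤ (choose-growth-≥ q r u) (choose-monoˡ-≤ u (m≤m+n q r)) ⟩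
  (q + r) choose suc u + (q + r) choose u
    ≡⟨ +-comm _ ((q + r) choose u) ⟩
  suc (q + r) choose suc u
    ≡⟨ cong (_choose suc u) (sym (+-suc q r)) ⟩
  (q + suc r) choose suc u ∎
  where
  open ≤-Reasoning

choose-growth-≤ : ∀ a r u → (a + r) choose suc u ≤ a choose suc u + r * ((a + r) choose u)
choose-growth-≤ a zero u = ≤-reflexive (trans (cong (_choose suc u) (+-identityʳ a)) (sym (+-identityʳ _)))
choose-growth-≤ a (suc r) u = begin
  (a + suc r) choose suc u
    ≡⟨ cong (_choose suc u) (+-suc a r) ⟩
  (a + r) choose u + (a + r) choose suc u
    ≤⟨ +-monoʳ-≤ ((a + r) choose u) (choose-growth-≤ a r u) ⟩
  (a + r) choose u + (a choose suc u + r * ((a + r) choose u))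
    ≤⟨ +-mono-≤ (choose-≤-suc (a + r) u) (+-monoʳ-≤ (a choose suc u) (*-monoʳ-≤ r (choose-≤-suc (a + r) u))) ⟩
  suc (a + r) choose u + (a choose suc u + r * (suc (a + r) choose u))
    ≡⟨ x+[y+r*x]≡y+[1+r]*x (suc (a + r) choose u) (a choose suc u) r ⟩
  a choose suc u + suc r * (suc (a + r) choose u)
    ≡⟨ cong (λ z → a choose suc u + suc r * (z choose u)) (sym (+-suc a r)) ⟩
  a choose suc u + suc r * ((a + suc r) choose u) ∎
  where
  open ≤-Reasoning
  x+[y+r*x]≡y+[1+r]*x : ∀ x y r → x + (y + r * x) ≡ y + suc r * x
  x+[y+r*x]≡y+[1+r]*x = solve-∀

-- a ↦ a choose (1+u) lies above its tangent line at q, of slope q choose u (stated without subtraction).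
choose-tangent : ∀ a q u → q choose suc u + a * (q choose u) ≤ a choose suc u + q * (q choose u)
choose-tangent a q u with ≤-total q a
... | inj₁ q≤a with m≤n⇒∃[o]m+o≡n q≤a
...   | r , refl = begin
  q choose suc u + (q + r) * (q choose u)
    ≡⟨ cong (q choose suc u +_) (*-distribʳ-+ (q choose u) q r) ⟩
  q choose suc u + (q * (q choose u) + r * (q choose u))
    ≡⟨ x+[y+z]≡[x+z]+y (q choose suc u) _ _ ⟩
  (q choose suc u + r * (q choose u)) + q * (q choose u)
    ≤⟨ +-monoˡ-≤ _ (choose-growth-≥ q r u) ⟩
  (q + r) choose suc u + q * (q choose u) ∎
  where
  open ≤-Reasoning
choose-tangent a q u | inj₂ a≤q with m≤n⇒∃[o]m+o≡n a≤q
...   | r , refl = begin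
  (a + r) choose suc u + a * c
    ≤⟨ +-monoˡ-≤ _ (choose-growth-≤ a r u) ⟩
  a choose suc u + r * c + a * c
    ≡⟨ x+y*z+w*z≡x+[w+y]*z (a choose suc u) r c a ⟩
  a choose suc u + (a + r) * c ∎
  where
  c : ℕ
  c = (a + r) choose u
  open ≤-Reasoning
  x+y*z+w*z≡x+[w+y]*z : ∀ x y z w → x + y * z + w * z ≡ x + (w + y) * z
  x+y*z+w*z≡x+[w+y]*z = solve-∀

-- Jensen's inequality for a ↦ a choose (1+u), with weights w and the mean rounded down.
choose-jensen : ∀ {n} (w a : Subset n → ℕ) u → .{{_ : NonZero (sumˢ w)}} →
  sumˢ w * ((∑ˢ[ y ] (w y * a y) / sumˢ w) choose suc u) ≤ ∑ˢ[ y ] (w y * (a y choose suc u))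
choose-jensen w a u = +-cancelʳ-≤ (N * q * D) _ _ (begin
  N * (q choose suc u) + N * q * D
    ≤⟨ +-monoʳ-≤ _ (*-monoˡ-≤ D (≤-trans (≤-reflexive (*-comm N q)) (m/n*n≤m A N))) ⟩
  N * (q choose suc u) + A * D
    ≡⟨ sym (cong₂ _+_ (*-distribʳ-sumˢ (q choose suc u) w) (*-distribʳ-sumˢ D (λ y → w y * a y))) ⟩
  ∑ˢ[ y ] (w y * (q choose suc u)) + ∑ˢ[ y ] (w y * a y * D)
    ≡⟨ sym (sumˢ-distrib-+ (λ y → w y * (q choose suc u)) _) ⟩
  ∑ˢ[ y ] (w y * (q choose suc u) + w y * a y * D)
    ≤⟨ sumˢ-mono-≤ weighted-tangent ⟩
  ∑ˢ[ y ] (w y * (a y choose suc u) + w y * q * D)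
    ≡⟨ sumˢ-distrib-+ (λ y → w y * (a y choose suc u)) _ ⟩
  X + ∑ˢ[ y ] (w y * q * D)
    ≡⟨ cong (X +_) (trans (*-distribʳ-sumˢ D (λ y → w y * q)) (cong (_* D) (*-distribʳ-sumˢ q w))) ⟩
  X + N * q * D ∎)
  where
  open ≤-Reasoning
  N : ℕ
  N = sumˢ w
  A : ℕ
  A = ∑ˢ[ y ] (w y * a y)
  X : ℕ
  X = ∑ˢ[ y ] (w y * (a y choose suc u))
  q : ℕ
  q = A / N
  D : ℕ
  D = q choose u
  weighted-tangent : ∀ y → w y * (q choose suc u) + w y * a y * D ≤ w y * (a y choose suc u) + w y * q * D
  weighted-tangent y = begin
    w y * (q choose suc u) + w y * a y * D
      ≡⟨ cong₂ _+_ refl (*-assoc (w y) (a y) D) ⟩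
    w y * (q choose suc u) + w y * (a y * D)
      ≡⟨ sym (*-distribˡ-+ (w y) _ _) ⟩
    w y * (q choose suc u + a y * D)
      ≤⟨ *-monoʳ-≤ (w y) (choose-tangent (a y) q u) ⟩
    w y * (a y choose suc u + q * D)
      ≡⟨ *-distribˡ-+ (w y) _ _ ⟩
    w y * (a y choose suc u) + w y * (q * D)
      ≡⟨ cong₂ _+_ refl (sym (*-assoc (w y) q D)) ⟩
    w y * (a y choose suc u) + w y * q * D ∎

-- Subsets

_⊆ᵇ_ : ∀ {n} → Subset n → Subset n → Bool
[] ⊆ᵇ [] = true
(false ∷ s) ⊆ᵇ (_ ∷ t) = s ⊆ᵇ t
(true ∷ s) ⊆ᵇ (b ∷ t) = b ∧ s ⊆ᵇ t

⊆ᵇ-sound : ∀ {n} (s t : Subset n) x → s ⊆ᵇ t ≡ true → lookup s x ≡ true → lookup t x ≡ true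
⊆ᵇ-sound (true ∷ s) (true ∷ t) zero _ _ = refl
⊆ᵇ-sound (false ∷ s) (_ ∷ t) (suc x) s⊆t x∈s = ⊆ᵇ-sound s t x s⊆t x∈s
⊆ᵇ-sound (true ∷ s) (true ∷ t) (suc x) s⊆t x∈s = ⊆ᵇ-sound s t x s⊆t x∈s

⊆ᵇ-∩ : ∀ {n} (s t t' : Subset n) → s ⊆ᵇ t ∧ s ⊆ᵇ t' ≡ s ⊆ᵇ (t ∩ t')
⊆ᵇ-∩ [] [] [] = refl
⊆ᵇ-∩ (false ∷ s) (_ ∷ t) (_ ∷ t') = ⊆ᵇ-∩ s t t'
⊆ᵇ-∩ (true ∷ s) (b ∷ t) (b' ∷ t') = trans (∧-interchange b (s ⊆ᵇ t) b' (s ⊆ᵇ t')) (cong ((b ∧ b') ∧_) (⊆ᵇ-∩ s t t'))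
  where
  ∧-interchange : ∀ a b c d → (a ∧ b) ∧ (c ∧ d) ≡ (a ∧ c) ∧ (b ∧ d)
  ∧-interchange true b true d = refl
  ∧-interchange true b false d = ∧-zeroʳ b
  ∧-interchange false b c d = refl

count-of-size : ∀ n r → sumˢ {n} (λ s → ⟦ ∣ s ∣ ≡ᵇ r ⟧) ≡ n choose r
count-of-size zero zero = refl
count-of-size zero (suc r) = refl
count-of-size (suc n) zero = cong₂ _+_ (count-of-size n 0) (sumˢ-zero n)
count-of-size (suc n) (suc r) = trans (cong₂ _+_ (count-of-size n (suc r)) (count-of-size n r)) (+-comm (n choose suc r) (n choose r))

count-⊆-of-size : ∀ {n} (t : Subset n) r → ∑ˢ[ s ] ⟦ s ⊆ᵇ t ∧ (∣ s ∣ ≡ᵇ r) ⟧ ≡ ∣ t ∣ choose r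
count-⊆-of-size [] zero = refl
count-⊆-of-size [] (suc r) = refl
count-⊆-of-size {suc n} (false ∷ t) r = trans (cong₂ _+_ (count-⊆-of-size t r) (sumˢ-zero n)) (+-identityʳ _)
count-⊆-of-size {suc n} (true ∷ t) zero =
  cong₂ _+_ (count-⊆-of-size t 0) (trans (sumˢ-cong (λ s → cong ⟦_⟧ (∧-zeroʳ (s ⊆ᵇ t)))) (sumˢ-zero n))
count-⊆-of-size (true ∷ t) (suc r) =
  trans (cong₂ _+_ (count-⊆-of-size t (suc r)) (count-⊆-of-size t r)) (+-comm (∣ t ∣ choose suc r) (∣ t ∣ choose r))

sumˢ-size-0 : ∀ {n} (h : Subset n → Bool) → ∑ˢ[ y ] ⟦ (∣ y ∣ ≡ᵇ 0) ∧ h y ⟧ ≡ ⟦ h ∅ ⟧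
sumˢ-size-0 {zero} h = refl
sumˢ-size-0 {suc n} h = trans (cong (_+ sumˢ {n} (λ _ → 0)) (sumˢ-size-0 (h ∘ (false ∷_)))) (trans (cong (⟦ h ∅ ⟧ +_) (sumˢ-zero n)) (+-identityʳ _))

⁅x⁆∪p≡p : ∀ {n} {x : Fin n} {p} → x ∈ p → ⁅ x ⁆ ∪ p ≡ p
⁅x⁆∪p≡p {x = x} {p} x∈p = ⊆-antisym absorbed (q⊆p∪q ⁅ x ⁆ p)
  where
  absorbed : ⁅ x ⁆ ∪ p ⊆ p
  absorbed z∈∪ with x∈p∪q⁻ ⁅ x ⁆ p z∈∪
  ... | inj₁ z∈⁅x⁆ rewrite x∈⁅y⁆⇒x≡y x z∈⁅x⁆ = x∈p
  ... | inj₂ z∈p = z∈p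

nonempty-of-size : ∀ {n} (p : Subset n) → 1 ≤ ∣ p ∣ → Nonempty p
nonempty-of-size {n} p 1≤∣p∣ with nonempty? p
... | yes nonempty = nonempty
... | no empty with () ← ≤-trans 1≤∣p∣ (≤-reflexive (trans (cong ∣_∣ (Empty-unique empty)) (∣⊥∣≡0 n)))

∈-image⁺ : ∀ {n k} (f : Fin k → Fin n) i → f i ∈ image f
∈-image⁺ f i = lookup⇒[]= (f i) (image f)
  (trans (lookup∘tabulate _ (f i)) (T⇒≡true (any⁺ _ (tabulate⁺ i (fromWitness refl)))))

∈-image⁻ : ∀ {n k} (f : Fin k → Fin n) {z} → z ∈ image f → ∃[ i ] f i ≡ z
∈-image⁻ {k = k} f {z} z∈image
  with tabulate⁻ (any⁻ _ (allFin k) (≡true⇒T (trans (sym (lookup∘tabulate _ z)) ([]=⇒lookup z∈image))))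
... | i , fi≟z = i , toWitness fi≟z

inject₁-or-last : ∀ {k} (i : Fin (suc k)) → (∃[ i′ ] i ≡ inject₁ i′) ⊎ i ≡ fromℕ k
inject₁-or-last {zero} zero = inj₂ refl
inject₁-or-last {suc k} zero = inj₁ (zero , refl)
inject₁-or-last {suc k} (suc i) with inject₁-or-last i
... | inj₁ (i′ , refl) = inj₁ (suc i′ , refl)
... | inj₂ refl = inj₂ refl

image-last : ∀ {n k} (f : Fin (suc k) → Fin n) → image f ≡ ⁅ f (fromℕ k) ⁆ ∪ image (f ∘ inject₁)
image-last {n} {k} f = ⊆-antisym ⊆-split ⊇-split
  where
  ⊆-split : image f ⊆ ⁅ f (fromℕ k) ⁆ ∪ image (f ∘ inject₁)
  ⊆-split z∈image with ∈-image⁻ f z∈image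
  ... | i , refl with inject₁-or-last i
  ...   | inj₁ (i′ , refl) = x∈p∪q⁺ (inj₂ (∈-image⁺ (f ∘ inject₁) i′))
  ...   | inj₂ refl = x∈p∪q⁺ (inj₁ (x∈⁅x⁆ (f (fromℕ k))))
  ⊇-split : ⁅ f (fromℕ k) ⁆ ∪ image (f ∘ inject₁) ⊆ image f
  ⊇-split z∈∪ with x∈p∪q⁻ ⁅ f (fromℕ k) ⁆ (image (f ∘ inject₁)) z∈∪
  ... | inj₁ z∈⁅last⁆ rewrite x∈⁅y⁆⇒x≡y _ z∈⁅last⁆ = ∈-image⁺ f (fromℕ k)
  ... | inj₂ z∈image′ with ∈-image⁻ (f ∘ inject₁) z∈image′
  ...   | i′ , refl = ∈-image⁺ f (inject₁ i′)

image-1 : ∀ {n} (f : Fin 1 → Fin n) → image f ≡ ⁅ f zero ⁆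
image-1 f = ⊆-antisym image⊆ (λ z∈⁅⁆ → subst (_∈ image f) (sym (x∈⁅y⁆⇒x≡y _ z∈⁅⁆)) (∈-image⁺ f zero))
  where
  image⊆ : image f ⊆ ⁅ f zero ⁆
  image⊆ z∈image with ∈-image⁻ f z∈image
  ... | zero , refl = x∈⁅x⁆ (f zero)

lookup-∷ʳ-inject₁ : ∀ {A : Set} {k} (v : Vec A k) x i → lookup (v ∷ʳ x) (inject₁ i) ≡ lookup v i
lookup-∷ʳ-inject₁ (a ∷ v) x zero = refl
lookup-∷ʳ-inject₁ (a ∷ v) x (suc i) = lookup-∷ʳ-inject₁ v x i

lookup-∷ʳ-last : ∀ {A : Set} {k} (v : Vec A k) x → lookup (v ∷ʳ x) (fromℕ k) ≡ x
lookup-∷ʳ-last [] x = refl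
lookup-∷ʳ-last (a ∷ v) x = lookup-∷ʳ-last v x

all-allFin-suc : ∀ {n} (p : Fin (suc n) → Bool) → all p (allFin (suc n)) ≡ p zero ∧ all (p ∘ suc) (allFin n)
all-allFin-suc p = cong (λ bs → p zero ∧ and bs) (trans (map-tabulate suc p) (sym (map-tabulate id (p ∘ suc))))

all-allFin-⊆ᵇ : ∀ {n} (s : Subset n) (c : Fin n → Bool) → all (λ x → not (lookup s x) ∨ c x) (allFin n) ≡ s ⊆ᵇ tabulate c
all-allFin-⊆ᵇ [] c = refl
all-allFin-⊆ᵇ (b ∷ s) c =
  trans (all-allFin-suc (λ x → not (lookup (b ∷ s) x) ∨ c x)) (head-case b (all-allFin-⊆ᵇ s (c ∘ suc)))
  where
  head-case : ∀ b {rest} → rest ≡ s ⊆ᵇ tabulate (c ∘ suc) → (not b ∨ c zero) ∧ rest ≡ (b ∷ s) ⊆ᵇ tabulate c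
  head-case true refl = refl
  head-case false refl = refl

-- Degrees and links

edges≡sumˢ : ∀ {n} (E : Hyp n) → edges E ≡ ∑ˢ[ s ] ⟦ E s ⟧
edges≡sumˢ {n} E = count-allSubsets n E

deg≡sumˢ : ∀ {n} (E : Hyp n) x → deg E x ≡ ∑ˢ[ s ] ⟦ E s ∧ lookup s x ⟧
deg≡sumˢ {n} E x = count-allSubsets n (λ s → E s ∧ lookup s x)

handshake : ∀ {n} j (E : Hyp n) → Uniform j E → ∑[ x < n ] deg E x ≡ j * edges E
handshake {n} j E uniform = begin
  ∑[ x < n ] deg E x
    ≡⟨ sum-cong-≗ (deg≡sumˢ E) ⟩
  ∑[ x < n ] ∑ˢ[ s ] ⟦ E s ∧ lookup s x ⟧
    ≡⟨ ∑-sumˢ-comm (λ x s → ⟦ E s ∧ lookup s x ⟧) ⟩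
  ∑ˢ[ s ] ∑[ x < n ] ⟦ E s ∧ lookup s x ⟧
    ≡⟨ sumˢ-cong (λ s → trans (sum-cong-≗ (λ x → ⟦∧⟧ (E s) (lookup s x)))
                       (trans (sym (*-distribˡ-sum ⟦ E s ⟧ (λ x → ⟦ lookup s x ⟧))) (cong (⟦ E s ⟧ *_) (sym (∣∣≡∑ s))))) ⟩
  ∑ˢ[ s ] (⟦ E s ⟧ * ∣ s ∣)
    ≡⟨ sumˢ-cong edge-size ⟩
  ∑ˢ[ s ] (j * ⟦ E s ⟧)
    ≡⟨ *-distribˡ-sumˢ j (⟦_⟧ ∘ E) ⟩
  j * ∑ˢ[ s ] ⟦ E s ⟧
    ≡⟨ cong (j *_) (sym (edges≡sumˢ E)) ⟩
  j * edges E ∎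
  where
  open ≡-Reasoning
  edge-size : ∀ s → ⟦ E s ⟧ * ∣ s ∣ ≡ j * ⟦ E s ⟧
  edge-size s with E s in eq
  ... | true = trans (+-identityʳ ∣ s ∣) (trans (uniform s eq) (sym (*-identityʳ j)))
  ... | false = sym (*-zeroʳ j)

edges≤choose : ∀ {n} j (E : Hyp n) → Uniform j E → edges E ≤ n choose j
edges≤choose {n} j E uniform = begin
  edges E                      ≡⟨ edges≡sumˢ E ⟩
  ∑ˢ[ s ] ⟦ E s ⟧              ≤⟨ sumˢ-mono-≤ edge-of-size-j ⟩
  sumˢ {n} (λ s → ⟦ ∣ s ∣ ≡ᵇ j ⟧) ≡⟨ count-of-size n j ⟩
  n choose j                   ∎
  where
  open ≤-Reasoning
  edge-of-size-j : ∀ s → ⟦ E s ⟧ ≤ ⟦ ∣ s ∣ ≡ᵇ j ⟧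
  edge-of-size-j s with E s in eq
  ... | false = z≤n
  ... | true rewrite uniform s eq | ≡ᵇ-refl j = ≤-refl

-- Pair each vertex of W with each vertex outside W.
top-average : ∀ {n} (W : Subset n) (g : Fin n → ℕ) →
  (∀ x y → lookup W x ≡ true → lookup W y ≡ false → g y ≤ g x) →
  ∣ W ∣ * ∑[ x < n ] g x ≤ n * ∑[ x < n ] (⟦ lookup W x ⟧ * g x)
top-average {n} W g top = begin
  ∣ W ∣ * ∑[ x < n ] g x      ≡⟨ cong₂ _*_ (∣∣≡∑ W) (sym inside+outside) ⟩
  ∣W∣ * (I + O)               ≡⟨ *-distribˡ-+ ∣W∣ I O ⟩
  ∣W∣ * I + ∣W∣ * O           ≤⟨ +-monoʳ-≤ (∣W∣ * I) outside≤inside ⟩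
  ∣W∣ * I + ∣∁W∣ * I          ≡⟨ sym (*-distribʳ-+ I ∣W∣ ∣∁W∣) ⟩
  (∣W∣ + ∣∁W∣) * I            ≡⟨ cong (_* I) ∣W∣+∣∁W∣≡n ⟩
  n * I                       ∎
  where
  open ≤-Reasoning
  in? out? : Fin n → ℕ
  in? x = ⟦ lookup W x ⟧
  out? x = ⟦ not (lookup W x) ⟧
  ∣W∣ : ℕ
  ∣W∣ = ∑[ x < n ] in? x
  ∣∁W∣ : ℕ
  ∣∁W∣ = ∑[ x < n ] out? x
  I : ℕ
  I = ∑[ x < n ] (in? x * g x)
  O : ℕ
  O = ∑[ x < n ] (out? x * g x)
  split : ∀ b v → ⟦ b ⟧ * v + ⟦ not b ⟧ * v ≡ v
  split true v = trans (+-identityʳ (v + 0)) (+-identityʳ v)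
  split false v = +-identityʳ v
  inside+outside : I + O ≡ ∑[ x < n ] g x
  inside+outside = trans (sym (∑-distrib-+ (λ x → in? x * g x) _)) (sum-cong-≗ (λ x → split (lookup W x) (g x)))
  ∣W∣+∣∁W∣≡n : ∣W∣ + ∣∁W∣ ≡ n
  ∣W∣+∣∁W∣≡n = trans (sym (∑-distrib-+ in? out?)) (trans (sum-cong-≗ (λ x → ⟦b⟧+⟦not-b⟧≡1 (lookup W x))) (∑-1≡n n))
    where
    ⟦b⟧+⟦not-b⟧≡1 : ∀ b → ⟦ b ⟧ + ⟦ not b ⟧ ≡ 1
    ⟦b⟧+⟦not-b⟧≡1 true = refl
    ⟦b⟧+⟦not-b⟧≡1 false = refl
    ∑-1≡n : ∀ n → ∑[ x < n ] 1 ≡ n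
    ∑-1≡n zero = refl
    ∑-1≡n (suc n) = cong suc (∑-1≡n n)
  pair : ∀ x y → in? x * (out? y * g y) ≤ out? y * (in? x * g x)
  pair x y with lookup W x in x∈W | lookup W y in y∈W
  ... | false | _ = z≤n
  ... | true | true = z≤n
  ... | true | false = +-monoˡ-≤ 0 (+-monoˡ-≤ 0 (top x y x∈W y∈W))
  outside≤inside : ∣W∣ * O ≤ ∣∁W∣ * I
  outside≤inside = begin
    ∣W∣ * O                                        ≡⟨ *-distribʳ-sum O in? ⟩
    ∑[ x < n ] (in? x * O)                         ≡⟨ sum-cong-≗ (λ x → *-distribˡ-sum (in? x) (λ y → out? y * g y)) ⟩
    ∑[ x < n ] ∑[ y < n ] (in? x * (out? y * g y)) ≤⟨ ∑-mono-≤ (λ x → ∑-mono-≤ (pair x)) ⟩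
    ∑[ x < n ] ∑[ y < n ] (out? y * (in? x * g x)) ≡⟨ ∑-comm (λ x y → out? y * (in? x * g x)) ⟩
    ∑[ y < n ] ∑[ x < n ] (out? y * (in? x * g x)) ≡⟨ sum-cong-≗ (λ y → sym (*-distribˡ-sum (out? y) (λ x → in? x * g x))) ⟩
    ∑[ y < n ] (out? y * I)                        ≡⟨ sym (*-distribʳ-sum I out?) ⟩
    ∣∁W∣ * I                                       ∎

link : ∀ {n} → Hyp n → Subset n → Subset n
link E y = tabulate (λ x → E (⁅ x ⁆ ∪ y))

lookup-link : ∀ {n} (E : Hyp n) y x → lookup (link E y) x ≡ E (⁅ x ⁆ ∪ y)
lookup-link E y = lookup∘tabulate (λ x → E (⁅ x ⁆ ∪ y))

-- Every edge s ∋ x of size 1+r is ⁅ x ⁆ ∪ y for the r-set y = s without x.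
edges-through≤links : ∀ {n} (E : Hyp n) r x →
  ∑ˢ[ s ] ⟦ E s ∧ lookup s x ∧ (∣ s ∣ ≡ᵇ suc r) ⟧ ≤ ∑ˢ[ y ] ⟦ (∣ y ∣ ≡ᵇ r) ∧ E (⁅ x ⁆ ∪ y) ⟧
edges-through≤links {suc n} E r zero = begin
  ∑ˢ[ s ] ⟦ E (false ∷ s) ∧ false ∧ (∣ s ∣ ≡ᵇ suc r) ⟧ + ∑ˢ[ s ] ⟦ E (true ∷ s) ∧ true ∧ (∣ s ∣ ≡ᵇ r) ⟧
    ≡⟨ cong₂ _+_ (trans (sumˢ-cong (λ s → cong ⟦_⟧ (∧-zeroʳ (E (false ∷ s))))) (sumˢ-zero n))
                 (sumˢ-cong (λ s → cong ⟦_⟧ (trans (∧-comm (E (true ∷ s)) _)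
                                               (cong (λ z → (∣ s ∣ ≡ᵇ r) ∧ E (true ∷ z)) (sym (∪-identityˡ s)))))) ⟩
  ∑ˢ[ y ] ⟦ (∣ y ∣ ≡ᵇ r) ∧ E (true ∷ (∅ ∪ y)) ⟧
    ≤⟨ m≤m+n _ _ ⟩
  ∑ˢ[ y ] ⟦ (∣ y ∣ ≡ᵇ r) ∧ E (true ∷ (∅ ∪ y)) ⟧ + ∑ˢ[ y ] ⟦ (suc ∣ y ∣ ≡ᵇ r) ∧ E (true ∷ (∅ ∪ y)) ⟧ ∎
  where open ≤-Reasoning
edges-through≤links {suc n} E zero (suc x) =
  +-mono-≤ (edges-through≤links (E ∘ (false ∷_)) zero x) (≤-trans (≤-reflexive (trans (sumˢ-cong no-nonempty-0-set) (sumˢ-zero n))) z≤n)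
  where
  nonempty : ∀ {n} (s : Subset n) x → lookup s x ≡ true → (∣ s ∣ ≡ᵇ 0) ≡ false
  nonempty (true ∷ s) zero _ = refl
  nonempty (true ∷ s) (suc x) _ = refl
  nonempty (false ∷ s) (suc x) x∈s = nonempty s x x∈s
  no-nonempty-0-set : ∀ s → ⟦ E (true ∷ s) ∧ lookup s x ∧ (∣ s ∣ ≡ᵇ 0) ⟧ ≡ 0
  no-nonempty-0-set s with lookup s x in x∈s
  ... | false = cong ⟦_⟧ (∧-zeroʳ (E (true ∷ s)))
  ... | true rewrite nonempty s x x∈s = cong ⟦_⟧ (∧-zeroʳ (E (true ∷ s)))
edges-through≤links {suc n} E (suc r) (suc x) =
  +-mono-≤ (edges-through≤links (E ∘ (false ∷_)) (suc r) x) (edges-through≤links (E ∘ (true ∷_)) r x)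

deg≤links : ∀ {n} r (E : Hyp n) → Uniform (suc r) E → ∀ x →
  deg E x ≤ ∑ˢ[ y ] ⟦ (∣ y ∣ ≡ᵇ r) ∧ E (⁅ x ⁆ ∪ y) ⟧
deg≤links r E uniform x = begin
  deg E x                                           ≡⟨ deg≡sumˢ E x ⟩
  ∑ˢ[ s ] ⟦ E s ∧ lookup s x ⟧                      ≡⟨ sumˢ-cong edge-size ⟩
  ∑ˢ[ s ] ⟦ E s ∧ lookup s x ∧ (∣ s ∣ ≡ᵇ suc r) ⟧   ≤⟨ edges-through≤links E r x ⟩
  ∑ˢ[ y ] ⟦ (∣ y ∣ ≡ᵇ r) ∧ E (⁅ x ⁆ ∪ y) ⟧         ∎
  where
  open ≤-Reasoning
  edge-size : ∀ s → ⟦ E s ∧ lookup s x ⟧ ≡ ⟦ E s ∧ lookup s x ∧ (∣ s ∣ ≡ᵇ suc r) ⟧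
  edge-size s with E s in eq
  ... | false = refl
  ... | true rewrite uniform s eq | ≡ᵇ-refl r = cong ⟦_⟧ (sym (∧-identityʳ (lookup s x)))

edges≤∣singletons∣ : ∀ {n} (E : Hyp n) → Uniform 1 E → edges E ≤ ∣ tabulate (λ x → E ⁅ x ⁆) ∣
edges≤∣singletons∣ {n} E uniform = begin
  edges E                          ≡⟨ sym (+-identityʳ (edges E)) ⟩
  1 * edges E                      ≡⟨ sym (handshake 1 E uniform) ⟩
  ∑[ x < n ] deg E x               ≤⟨ ∑-mono-≤ (λ x → deg≤links 0 E uniform x) ⟩
  ∑[ x < n ] ∑ˢ[ y ] ⟦ (∣ y ∣ ≡ᵇ 0) ∧ E (⁅ x ⁆ ∪ y) ⟧
    ≡⟨ sum-cong-≗ (λ x → trans (sumˢ-size-0 (λ y → E (⁅ x ⁆ ∪ y))) (cong (⟦_⟧ ∘ E) (∪-identityʳ ⁅ x ⁆))) ⟩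
  ∑[ x < n ] ⟦ E ⁅ x ⁆ ⟧
    ≡⟨ sym (trans (∣∣≡∑ (tabulate (λ x → E ⁅ x ⁆))) (sum-cong-≗ (cong ⟦_⟧ ∘ lookup∘tabulate (λ x → E ⁅ x ⁆)))) ⟩
  ∣ tabulate (λ x → E ⁅ x ⁆) ∣     ∎
  where open ≤-Reasoning

Slink-spec : ∀ {n} j (E : Hyp n) T y → Slink j E T y ≡ (∣ y ∣ ≡ᵇ j ∸ 1) ∧ T ⊆ᵇ link E y
Slink-spec j E T y = cong₂ _∧_ (⌊≟⌋≡≡ᵇ ∣ y ∣ (j ∸ 1)) (all-allFin-⊆ᵇ T (λ x → E (⁅ x ⁆ ∪ y)))

Slink-size : ∀ {n} j (E : Hyp n) T y → Slink j E T y ≡ true → ∣ y ∣ ≡ j ∸ 1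
Slink-size j E T y y∈S = ≡ᵇ-sound _ _ (∧-true-left _ _ (trans (sym (Slink-spec j E T y)) y∈S))

Slink-edge : ∀ {n} j (E : Hyp n) T y {x} → x ∈ T → Slink j E T y ≡ true → E (⁅ x ⁆ ∪ y) ≡ true
Slink-edge j E T y {x} x∈T y∈S = trans (sym (lookup-link E y x))
  (⊆ᵇ-sound T (link E y) x (∧-true-right _ _ (trans (sym (Slink-spec j E T y)) y∈S)) ([]=⇒lookup x∈T))

Slink-avoids : ∀ {n} r (E : Hyp n) → Uniform (2 + r) E → ∀ T y {x} → x ∈ T → Slink (2 + r) E T y ≡ true → x ∉ y
Slink-avoids r E uniform T y x∈T y∈S x∈y = 1+n≢n (begin
  suc (suc r)      ≡⟨ sym (uniform y (subst (λ s → E s ≡ true) (⁅x⁆∪p≡p x∈y) (Slink-edge (2 + r) E T y x∈T y∈S))) ⟩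
  ∣ y ∣            ≡⟨ Slink-size (2 + r) E T y y∈S ⟩
  suc r            ∎)
  where open ≡-Reasoning

-- Both sides count pairs (T, y) with T a candidate and y ∈ S_T: for fixed y, the candidates
-- with y ∈ S_T are the t-subsets of W ∩ link E y.
∑-Slink≡∑-choose-link : ∀ {n} r (E : Hyp n) W t →
  ∑ˢ[ T ] (⟦ T ⊆ᵇ W ∧ (∣ T ∣ ≡ᵇ t) ⟧ * edges (Slink (2 + r) E T))
    ≡ ∑ˢ[ y ] (⟦ ∣ y ∣ ≡ᵇ suc r ⟧ * (∣ W ∩ link E y ∣ choose t))
∑-Slink≡∑-choose-link r E W t = begin
  ∑ˢ[ T ] (⟦ candidate T ⟧ * edges (Slink (2 + r) E T))
    ≡⟨ sumˢ-cong (λ T → trans (cong (⟦ candidate T ⟧ *_) (edges≡sumˢ (Slink (2 + r) E T)))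
                              (sym (*-distribˡ-sumˢ ⟦ candidate T ⟧ (⟦_⟧ ∘ Slink (2 + r) E T)))) ⟩
  ∑ˢ[ T ] ∑ˢ[ y ] (⟦ candidate T ⟧ * ⟦ Slink (2 + r) E T y ⟧)
    ≡⟨ sumˢ-comm (λ T y → ⟦ candidate T ⟧ * ⟦ Slink (2 + r) E T y ⟧) ⟩
  ∑ˢ[ y ] ∑ˢ[ T ] (⟦ candidate T ⟧ * ⟦ Slink (2 + r) E T y ⟧)
    ≡⟨ sumˢ-cong (λ y → sumˢ-cong (incidence y)) ⟩
  ∑ˢ[ y ] ∑ˢ[ T ] (⟦ ∣ y ∣ ≡ᵇ suc r ⟧ * ⟦ T ⊆ᵇ (W ∩ link E y) ∧ (∣ T ∣ ≡ᵇ t) ⟧)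
    ≡⟨ sumˢ-cong (λ y → trans (*-distribˡ-sumˢ ⟦ ∣ y ∣ ≡ᵇ suc r ⟧ (λ T → ⟦ T ⊆ᵇ (W ∩ link E y) ∧ (∣ T ∣ ≡ᵇ t) ⟧))
                              (cong (⟦ ∣ y ∣ ≡ᵇ suc r ⟧ *_) (count-⊆-of-size (W ∩ link E y) t))) ⟩
  ∑ˢ[ y ] (⟦ ∣ y ∣ ≡ᵇ suc r ⟧ * (∣ W ∩ link E y ∣ choose t)) ∎
  where
  open ≡-Reasoning
  candidate : Subset _ → Bool
  candidate T = T ⊆ᵇ W ∧ (∣ T ∣ ≡ᵇ t)
  shuffle : ∀ a b c d → (a ∧ b) ∧ (c ∧ d) ≡ c ∧ ((a ∧ d) ∧ b)
  shuffle true true true d = sym (∧-comm d true)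
  shuffle true false true d = sym (∧-zeroʳ d)
  shuffle false b true d = refl
  shuffle a b false d = ∧-zeroʳ (a ∧ b)
  incidence : ∀ y T → ⟦ candidate T ⟧ * ⟦ Slink (2 + r) E T y ⟧
                    ≡ ⟦ ∣ y ∣ ≡ᵇ suc r ⟧ * ⟦ T ⊆ᵇ (W ∩ link E y) ∧ (∣ T ∣ ≡ᵇ t) ⟧
  incidence y T = begin
    ⟦ candidate T ⟧ * ⟦ Slink (2 + r) E T y ⟧
      ≡⟨ sym (⟦∧⟧ (candidate T) _) ⟩
    ⟦ candidate T ∧ Slink (2 + r) E T y ⟧
      ≡⟨ cong (λ b → ⟦ candidate T ∧ b ⟧) (Slink-spec (2 + r) E T y) ⟩
    ⟦ (T ⊆ᵇ W ∧ (∣ T ∣ ≡ᵇ t)) ∧ ((∣ y ∣ ≡ᵇ suc r) ∧ T ⊆ᵇ link E y) ⟧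
      ≡⟨ cong ⟦_⟧ (shuffle (T ⊆ᵇ W) _ _ (T ⊆ᵇ link E y)) ⟩
    ⟦ (∣ y ∣ ≡ᵇ suc r) ∧ ((T ⊆ᵇ W ∧ T ⊆ᵇ link E y) ∧ (∣ T ∣ ≡ᵇ t)) ⟧
      ≡⟨ cong (λ b → ⟦ (∣ y ∣ ≡ᵇ suc r) ∧ (b ∧ (∣ T ∣ ≡ᵇ t)) ⟧) (⊆ᵇ-∩ T W (link E y)) ⟩
    ⟦ (∣ y ∣ ≡ᵇ suc r) ∧ (T ⊆ᵇ (W ∩ link E y) ∧ (∣ T ∣ ≡ᵇ t)) ⟧
      ≡⟨ ⟦∧⟧ (∣ y ∣ ≡ᵇ suc r) _ ⟩
    ⟦ ∣ y ∣ ≡ᵇ suc r ⟧ * ⟦ T ⊆ᵇ (W ∩ link E y) ∧ (∣ T ∣ ≡ᵇ t) ⟧ ∎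

degrees≤links : ∀ {n} r (E : Hyp n) → Uniform (2 + r) E → ∀ W →
  ∑[ x < n ] (⟦ lookup W x ⟧ * deg E x) ≤ ∑ˢ[ y ] (⟦ ∣ y ∣ ≡ᵇ suc r ⟧ * ∣ W ∩ link E y ∣)
degrees≤links {n} r E uniform W = begin
  ∑[ x < n ] (⟦ lookup W x ⟧ * deg E x)
    ≤⟨ ∑-mono-≤ (λ x → *-monoʳ-≤ ⟦ lookup W x ⟧ (deg≤links (suc r) E uniform x)) ⟩
  ∑[ x < n ] (⟦ lookup W x ⟧ * ∑ˢ[ y ] ⟦ e y ∧ E (⁅ x ⁆ ∪ y) ⟧)
    ≡⟨ sum-cong-≗ (λ x → sym (*-distribˡ-sumˢ ⟦ lookup W x ⟧ (λ y → ⟦ e y ∧ E (⁅ x ⁆ ∪ y) ⟧))) ⟩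
  ∑[ x < n ] ∑ˢ[ y ] (⟦ lookup W x ⟧ * ⟦ e y ∧ E (⁅ x ⁆ ∪ y) ⟧)
    ≡⟨ ∑-sumˢ-comm (λ x y → ⟦ lookup W x ⟧ * ⟦ e y ∧ E (⁅ x ⁆ ∪ y) ⟧) ⟩
  ∑ˢ[ y ] ∑[ x < n ] (⟦ lookup W x ⟧ * ⟦ e y ∧ E (⁅ x ⁆ ∪ y) ⟧)
    ≡⟨ sumˢ-cong (λ y → trans (sum-cong-≗ (incidence y)) (trans (sym (*-distribˡ-sum ⟦ e y ⟧ (λ x → ⟦ lookup (W ∩ link E y) x ⟧)))
                                                               (cong (⟦ e y ⟧ *_) (sym (∣∣≡∑ (W ∩ link E y)))))) ⟩
  ∑ˢ[ y ] (⟦ e y ⟧ * ∣ W ∩ link E y ∣) ∎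
  where
  open ≤-Reasoning
  e : Subset n → Bool
  e y = ∣ y ∣ ≡ᵇ suc r
  swap-∧ : ∀ p w c → ⟦ w ⟧ * ⟦ p ∧ c ⟧ ≡ ⟦ p ⟧ * ⟦ w ∧ c ⟧
  swap-∧ true true c = refl
  swap-∧ true false c = refl
  swap-∧ false true c = refl
  swap-∧ false false c = refl
  incidence : ∀ y x → ⟦ lookup W x ⟧ * ⟦ e y ∧ E (⁅ x ⁆ ∪ y) ⟧ ≡ ⟦ e y ⟧ * ⟦ lookup (W ∩ link E y) x ⟧
  incidence y x rewrite lookup-zipWith _∧_ x W (link E y) | lookup-link E y x = swap-∧ (e y) (lookup W x) _

module DenseLink {n : ℕ} (r : ℕ) (E : Hyp n) (uniform : Uniform (2 + r) E) (W : Subset n) (u : ℕ)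
  (top : ∀ x y → lookup W x ≡ true → lookup W y ≡ false → deg E y ≤ deg E x)
  (W-large : 4 * suc u * (n choose (2 + r)) ≤ ∣ W ∣ * edges E)
  (n-large : 2 * suc r ≤ n)
  (m>0 : 0 < edges E) where

  private
    t : ℕ
    t = suc u
    m : ℕ
    m = edges E
    N₂ : ℕ
    N₂ = n choose (2 + r)
    candidate : Subset n → Bool
    candidate T = T ⊆ᵇ W ∧ (∣ T ∣ ≡ᵇ t)
    level : Subset n → ℕ
    level y = ⟦ ∣ y ∣ ≡ᵇ suc r ⟧
    a : Subset n → ℕ
    a y = ∣ W ∩ link E y ∣
    N₁ : ℕ
    N₁ = sumˢ level
    A : ℕ
    A = ∑ˢ[ y ] (level y * a y)
    X : ℕ
    X = ∑ˢ[ T ] (⟦ candidate T ⟧ * edges (Slink (2 + r) E T))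

    N₁≡choose : N₁ ≡ n choose suc r
    N₁≡choose = count-of-size n (suc r)

    instance
      N₁≢0 : NonZero N₁
      N₁≢0 = >-nonZero (subst (0 <_) (sym N₁≡choose) (0<choose (≤-trans (m≤m+n (suc r) (suc r + 0)) n-large)))

    q : ℕ
    q = A / N₁

    jensen-bound : N₁ * (q choose t) ≤ X
    jensen-bound = ≤-trans (choose-jensen level a u) (≤-reflexive (sym (∑-Slink≡∑-choose-link r E W t)))

    W*m≤2*N₂*[1+q] : ∣ W ∣ * m ≤ 2 * N₂ * suc q
    W*m≤2*N₂*[1+q] = *-cancelʳ-≤ _ _ ((2 + r) * n) {{m*n≢0 (2 + r) n {{_}} {{>-nonZero n>0}}}} (begin
      ∣ W ∣ * m * ((2 + r) * n)                  ≡⟨ reorder₁ ∣ W ∣ m (2 + r) n ⟩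
      n * (∣ W ∣ * ((2 + r) * m))                ≡⟨ cong (λ z → n * (∣ W ∣ * z)) (sym (handshake (2 + r) E uniform)) ⟩
      n * (∣ W ∣ * ∑[ x < n ] deg E x)           ≤⟨ *-monoʳ-≤ n (top-average W (deg E) top) ⟩
      n * (n * ∑[ x < n ] (⟦ lookup W x ⟧ * deg E x)) ≤⟨ *-monoʳ-≤ n (*-monoʳ-≤ n (degrees≤links r E uniform W)) ⟩
      n * (n * A)                                ≤⟨ *-monoʳ-≤ n (*-monoʳ-≤ n (m≤n*[1+m/n] A N₁)) ⟩
      n * (n * (N₁ * suc q))                     ≡⟨ reorder₂ n N₁ (suc q) ⟩
      n * N₁ * (n * suc q)                       ≤⟨ *-monoˡ-≤ (n * suc q) n*N₁≤2*[2+r]*N₂ ⟩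
      2 * (2 + r) * N₂ * (n * suc q)             ≡⟨ reorder₃ (2 + r) N₂ n (suc q) ⟩
      2 * N₂ * suc q * ((2 + r) * n)             ∎)
      where
      open ≤-Reasoning
      n>0 : 0 < n
      n>0 = ≤-trans (s≤s z≤n) n-large
      n*N₁≤2*[2+r]*N₂ : n * N₁ ≤ 2 * (2 + r) * N₂
      n*N₁≤2*[2+r]*N₂ = subst (λ z → n * z ≤ 2 * (2 + r) * N₂) (sym N₁≡choose) (n*nC[1+r]≤2*[2+r]*nC[2+r] n r n-large)
      reorder₁ : ∀ w m j n → w * m * (j * n) ≡ n * (w * (j * m))
      reorder₁ = solve-∀
      reorder₂ : ∀ n a b → n * (n * (a * b)) ≡ n * a * (n * b)
      reorder₂ = solve-∀
      reorder₃ : ∀ j c n b → 2 * j * c * (n * b) ≡ 2 * c * b * (j * n)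
      reorder₃ = solve-∀

    W*m≤4*N₂*[1+q∸t] : ∣ W ∣ * m ≤ 4 * N₂ * (suc q ∸ t)
    W*m≤4*N₂*[1+q∸t] = ≤-trans (m+n≤o⇒m≤o∸n (∣ W ∣ * m) (begin
      ∣ W ∣ * m + 4 * N₂ * t         ≡⟨ cong (∣ W ∣ * m +_) (*-right-comm 4 N₂ t) ⟩
      ∣ W ∣ * m + 4 * t * N₂         ≤⟨ +-monoʳ-≤ (∣ W ∣ * m) W-large ⟩
      ∣ W ∣ * m + ∣ W ∣ * m          ≤⟨ +-mono-≤ W*m≤2*N₂*[1+q] W*m≤2*N₂*[1+q] ⟩
      2 * N₂ * suc q + 2 * N₂ * suc q ≡⟨ twice N₂ (suc q) ⟩
      4 * N₂ * suc q                 ∎)) (≤-reflexive (sym (*-distribˡ-∸ (4 * N₂) (suc q) t)))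
      where
      open ≤-Reasoning
      *-right-comm : ∀ x y z → x * y * z ≡ x * z * y
      *-right-comm = solve-∀
      twice : ∀ c b → 2 * c * b + 2 * c * b ≡ 4 * c * b
      twice = solve-∀

    m≤N₂ : m ≤ N₂
    m≤N₂ = edges≤choose (2 + r) E uniform

    t≤∣W∣ : t ≤ ∣ W ∣
    t≤∣W∣ = ≤-trans (m≤m*n t 4) (*-cancelʳ-≤ (t * 4) ∣ W ∣ N₂ {{>-nonZero (≤-trans m>0 m≤N₂)}} (begin
      t * 4 * N₂     ≡⟨ cong (_* N₂) (*-comm t 4) ⟩
      4 * t * N₂     ≤⟨ W-large ⟩
      ∣ W ∣ * m      ≤⟨ *-monoʳ-≤ ∣ W ∣ m≤N₂ ⟩
      ∣ W ∣ * N₂     ∎))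
      where open ≤-Reasoning

    N₁*m^t*C[W,t]≤X*D : N₁ * m ^ t * (∣ W ∣ choose t) ≤ X * (4 * N₂) ^ t
    N₁*m^t*C[W,t]≤X*D = begin
      N₁ * m ^ t * (∣ W ∣ choose t)       ≡⟨ *-assoc N₁ (m ^ t) _ ⟩
      N₁ * (m ^ t * (∣ W ∣ choose t))     ≡⟨ cong (N₁ *_) (*-comm (m ^ t) _) ⟩
      N₁ * ((∣ W ∣ choose t) * m ^ t)     ≤⟨ *-monoʳ-≤ N₁ (choose*^≤choose*^ q ∣ W ∣ m (4 * N₂) t W*m≤4*N₂*[1+q∸t]) ⟩
      N₁ * ((q choose t) * (4 * N₂) ^ t)  ≡⟨ sym (*-assoc N₁ (q choose t) _) ⟩
      N₁ * (q choose t) * (4 * N₂) ^ t    ≤⟨ *-monoˡ-≤ ((4 * N₂) ^ t) jensen-bound ⟩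
      X * (4 * N₂) ^ t                    ∎
      where open ≤-Reasoning

    D : ℕ
    D = (4 * N₂) ^ t

    candidate-of-max : ∀ T → X ≤ ∑ˢ[ s ] ⟦ candidate s ⟧ * (⟦ candidate T ⟧ * edges (Slink (2 + r) E T)) →
      N₁ * m ^ t ≤ ⟦ candidate T ⟧ * edges (Slink (2 + r) E T) * D
    candidate-of-max T X≤∑*g = *-cancelʳ-≤ (N₁ * m ^ t) (g * D) (∣ W ∣ choose t) {{>-nonZero (0<choose t≤∣W∣)}} (begin
      N₁ * m ^ t * (∣ W ∣ choose t)   ≤⟨ N₁*m^t*C[W,t]≤X*D ⟩
      X * D                           ≤⟨ *-monoˡ-≤ D X≤∑*g ⟩
      ∑ˢ[ T ] ⟦ candidate T ⟧ * g * D ≡⟨ cong (λ z → z * g * D) (count-⊆-of-size W t) ⟩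
      (∣ W ∣ choose t) * g * D        ≡⟨ cong (_* D) (*-comm (∣ W ∣ choose t) g) ⟩
      g * (∣ W ∣ choose t) * D        ≡⟨ *-right-comm g _ D ⟩
      g * D * (∣ W ∣ choose t)        ∎)
      where
      open ≤-Reasoning
      g : ℕ
      g = ⟦ candidate T ⟧ * edges (Slink (2 + r) E T)
      *-right-comm : ∀ a b c → a * b * c ≡ a * c * b
      *-right-comm = solve-∀

  -- The test |S_T| ≥ s of the algorithm, for a t-subset T of W.
  dense-link : ∃[ T ] (T ⊆ᵇ W ∧ (∣ T ∣ ≡ᵇ suc u) ≡ true)
                    × ((n choose suc r) * edges E ^ suc u ≤ edges (Slink (2 + r) E T) * (4 * (n choose (2 + r))) ^ suc u)
  dense-link = T₀ , candidate-T₀ , subst (λ z → z * m ^ t ≤ edges (Slink (2 + r) E T₀) * D) N₁≡choose N₁*m^t≤edges*D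
    where
    max : ∃[ T ] (X ≤ ∑ˢ[ s ] ⟦ candidate s ⟧ * (⟦ candidate T ⟧ * edges (Slink (2 + r) E T)))
    max = sumˢ-≤-count*max candidate (edges ∘ Slink (2 + r) E)
    T₀ : Subset n
    T₀ = proj₁ max
    N₁*m^t≤g*D : N₁ * m ^ t ≤ ⟦ candidate T₀ ⟧ * edges (Slink (2 + r) E T₀) * D
    N₁*m^t≤g*D = candidate-of-max T₀ (proj₂ max)
    candidate-T₀ : candidate T₀ ≡ true
    candidate-T₀ = 0<⟦b⟧*k⇒b≡true (candidate T₀) (edges (Slink (2 + r) E T₀))
      (0<m*n⇒0<m (≤-trans (*-mono-≤ (>-nonZero⁻¹ N₁) (0<^ t m>0)) N₁*m^t≤g*D))
    N₁*m^t≤edges*D : N₁ * m ^ t ≤ edges (Slink (2 + r) E T₀) * D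
    N₁*m^t≤edges*D = ≤-trans N₁*m^t≤g*D
      (≤-reflexive (trans (cong (λ b → ⟦ b ⟧ * edges (Slink (2 + r) E T₀) * D) candidate-T₀) (cong (_* D) (+-identityʳ (edges (Slink (2 + r) E T₀))))))

-- The threshold t(n,d,j)

tCond-sound : ∀ n m j t → tCond n m j t ≡ true →
  0 < m × (16 * (n choose j)) ^ (t ^ (j ∸ 1)) ≤ n * m ^ (t ^ (j ∸ 1))
tCond-sound n m j t holds =
  <ᵇ⇒< 0 m (≡true⇒T (∧-true-left _ _ holds)) ,
  subst (λ c → (16 * c) ^ (t ^ (j ∸ 1)) ≤ n * m ^ (t ^ (j ∸ 1))) (C≡choose n j)
        (≤ᵇ⇒≤ _ _ (≡true⇒T (∧-true-right _ _ holds)))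

tCond-complete : ∀ n m j t → 0 < m → (16 * (n choose j)) ^ (t ^ (j ∸ 1)) ≤ n * m ^ (t ^ (j ∸ 1)) →
  tCond n m j t ≡ true
tCond-complete n m j t m>0 bound rewrite T⇒≡true (<⇒<ᵇ m>0) | C≡choose n j = T⇒≡true (≤⇒≤ᵇ bound)

tSearch-sound : ∀ n m j b → 1 ≤ tSearch n m j b → tCond n m j (tSearch n m j b) ≡ true
tSearch-sound n m j (suc b) found with tCond n m j (suc b) in holds
... | true = holds
... | false = tSearch-sound n m j b found

tSearch-greatest : ∀ n m j b t → tCond n m j t ≡ true → t ≤ b → t ≤ tSearch n m j b
tSearch-greatest n m j zero t _ z≤n = z≤n
tSearch-greatest n m j (suc b) t holds t≤1+b with tCond n m j (suc b) in holds′
... | true = t≤1+b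
... | false with m≤n⇒m<n∨m≡n t≤1+b
...   | inj₁ t≤b = tSearch-greatest n m j b t holds (<⇒≤pred t≤b)
...   | inj₂ refl with () ← trans (sym holds) holds′

module ThresholdBounds (n m r t K : ℕ) (2≤t : 2 ≤ t) (m≤K : m ≤ K) (m>0 : 0 < m)
  (threshold : (16 * K) ^ (t ^ suc r) ≤ n * m ^ (t ^ suc r)) where

  private
    e : ℕ
    e = t ^ suc r

    t≤e : t ≤ e
    t≤e = ≤-trans (≤-reflexive (sym (*-identityʳ t))) (*-monoʳ-≤ t (0<^ r (≤-trans (s≤s z≤n) 2≤t)))

    1+r≤e : suc r ≤ e
    1+r≤e = ≤-trans (n≤2^n (suc r)) (^-monoˡ-≤ (suc r) 2≤t)

    K>0 : 0 < K
    K>0 = ≤-trans m>0 m≤K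

    16^e*K≤n*m : 16 ^ e * K ≤ n * m
    16^e*K≤n*m = *-cancelʳ-≤ _ _ (K ^ e′) {{>-nonZero (0<^ e′ K>0)}} (begin
      16 ^ e * K * K ^ e′   ≡⟨ *-assoc (16 ^ e) K (K ^ e′) ⟩
      16 ^ e * K ^ suc e′   ≡⟨ cong (λ z → 16 ^ e * K ^ z) (sym e≡1+e′) ⟩
      16 ^ e * K ^ e        ≡⟨ sym ([m*n]^k≡m^k*n^k 16 K e) ⟩
      (16 * K) ^ e          ≤⟨ threshold ⟩
      n * m ^ e             ≡⟨ cong (λ z → n * m ^ z) e≡1+e′ ⟩
      n * (m * m ^ e′)      ≤⟨ *-monoʳ-≤ n (*-monoʳ-≤ m (^-monoˡ-≤ e′ m≤K)) ⟩
      n * (m * K ^ e′)      ≡⟨ sym (*-assoc n m (K ^ e′)) ⟩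
      n * m * K ^ e′        ∎)
      where
      open ≤-Reasoning
      e′ : ℕ
      e′ = e ∸ 1
      e≡1+e′ : e ≡ suc e′
      e≡1+e′ = sym (m+[n∸m]≡n {1} {e} (≤-trans (≤-trans (s≤s z≤n) 2≤t) t≤e))

    16^e≤n : 16 ^ e ≤ n
    16^e≤n = *-cancelʳ-≤ _ _ K {{>-nonZero K>0}} (≤-trans 16^e*K≤n*m (*-monoʳ-≤ n m≤K))

  2*[1+r]≤n : 2 * suc r ≤ n
  2*[1+r]≤n = ≤-trans (*-mono-≤ (s≤s (s≤s (z≤n {2}))) 1+r≤e) (≤-trans (4*n≤16^n e) 16^e≤n)

  t≤n : t ≤ n
  t≤n = ≤-trans t≤e (≤-trans (m≤n*m e 4) (≤-trans (4*n≤16^n e) 16^e≤n))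

  4*t*K≤n*m : 4 * t * K ≤ n * m
  4*t*K≤n*m = ≤-trans (*-monoˡ-≤ K (≤-trans (*-monoʳ-≤ 4 t≤e) (4*n≤16^n e))) 16^e*K≤n*m

-- The link density m′/K′ is at least (m/4K)^t while the exponent drops by the factor t;
-- the lost 4^(t e) is absorbed because 16^e * 4^(t e) ≤ 16^(t e) for t ≥ 2.
threshold-link : ∀ n m m′ K K′ t e → 0 < K → 2 ≤ t →
  (16 * K) ^ (t * e) ≤ n * m ^ (t * e) → m ^ t * K′ ≤ m′ * (4 ^ t * K ^ t) →
  (16 * K′) ^ e ≤ n * m′ ^ e
threshold-link n m m′ K K′ t e K>0 2≤t threshold dense =
  *-cancelʳ-≤ _ _ P {{>-nonZero (0<^ e (*-mono-≤ (0<^ t (s≤s z≤n)) (0<^ t K>0)))}} (begin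
  (16 * K′) ^ e * P
    ≡⟨ cong₂ _*_ ([m*n]^k≡m^k*n^k 16 K′ e) ([m*n]^k≡m^k*n^k (4 ^ t) (K ^ t) e) ⟩
  16 ^ e * K′ ^ e * ((4 ^ t) ^ e * (K ^ t) ^ e)
    ≡⟨ cong (λ z → 16 ^ e * K′ ^ e * z) (cong₂ _*_ (^-*-assoc 4 t e) (^-*-assoc K t e)) ⟩
  16 ^ e * K′ ^ e * (4 ^ (t * e) * K ^ (t * e))
    ≡⟨ reorder (16 ^ e) (K′ ^ e) (4 ^ (t * e)) (K ^ (t * e)) ⟩
  16 ^ e * 4 ^ (t * e) * (K ^ (t * e) * K′ ^ e)
    ≤⟨ *-monoˡ-≤ _ 16^e*4^[te]≤16^[te] ⟩
  16 ^ (t * e) * (K ^ (t * e) * K′ ^ e)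
    ≡⟨ sym (*-assoc (16 ^ (t * e)) _ _) ⟩
  16 ^ (t * e) * K ^ (t * e) * K′ ^ e
    ≡⟨ cong (_* K′ ^ e) (sym ([m*n]^k≡m^k*n^k 16 K (t * e))) ⟩
  (16 * K) ^ (t * e) * K′ ^ e
    ≤⟨ *-monoˡ-≤ (K′ ^ e) threshold ⟩
  n * m ^ (t * e) * K′ ^ e
    ≡⟨ cong (λ z → n * z * K′ ^ e) (sym (^-*-assoc m t e)) ⟩
  n * (m ^ t) ^ e * K′ ^ e
    ≡⟨ trans (*-assoc n _ _) (cong (n *_) (sym ([m*n]^k≡m^k*n^k (m ^ t) K′ e))) ⟩
  n * (m ^ t * K′) ^ e
    ≤⟨ *-monoʳ-≤ n (^-monoˡ-≤ e dense) ⟩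
  n * (m′ * (4 ^ t * K ^ t)) ^ e
    ≡⟨ trans (cong (n *_) ([m*n]^k≡m^k*n^k m′ _ e)) (sym (*-assoc n _ _)) ⟩
  n * m′ ^ e * P ∎)
  where
  open ≤-Reasoning
  P : ℕ
  P = (4 ^ t * K ^ t) ^ e
  reorder : ∀ a b c d → a * b * (c * d) ≡ a * c * (d * b)
  reorder = solve-∀
  16^e*4^[te]≤16^[te] : 16 ^ e * 4 ^ (t * e) ≤ 16 ^ (t * e)
  16^e*4^[te]≤16^[te] = begin
    16 ^ e * 4 ^ (t * e)       ≡⟨ cong (_* 4 ^ (t * e)) (^-*-assoc 4 2 e) ⟩
    4 ^ (2 * e) * 4 ^ (t * e)  ≡⟨ sym (^-distribˡ-+-* 4 (2 * e) (t * e)) ⟩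
    4 ^ (2 * e + t * e)        ≤⟨ ^-monoʳ-≤ 4 (+-monoˡ-≤ (t * e) (*-monoˡ-≤ e 2≤t)) ⟩
    4 ^ (t * e + t * e)        ≡⟨ cong (4 ^_) (sym (*-distribʳ-+ e t t)) ⟩
    4 ^ ((t + t) * e)          ≡⟨ cong (λ z → 4 ^ ((t + z) * e)) (sym (+-identityʳ t)) ⟩
    4 ^ ((t + (t + 0)) * e)    ≡⟨ cong (4 ^_) (*-assoc 2 t e) ⟩
    4 ^ (2 * (t * e))          ≡⟨ sym (^-*-assoc 4 2 (t * e)) ⟩
    16 ^ (t * e)               ∎

threshold-link₁ : ∀ n m m′ K t → 0 < K →
  (16 * K) ^ t ≤ n * m ^ t → m ^ t * n ≤ m′ * (4 ^ t * K ^ t) → t ≤ m′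
threshold-link₁ n m m′ K t K>0 threshold dense =
  ≤-trans (n≤2^n t) (≤-trans (^-monoˡ-≤ t (s≤s (s≤s z≤n)))
    (*-cancelʳ-≤ _ _ Q {{>-nonZero (*-mono-≤ (0<^ t (s≤s z≤n)) (0<^ t K>0))}} (begin
  4 ^ t * Q                ≡⟨ sym (*-assoc (4 ^ t) (4 ^ t) (K ^ t)) ⟩
  4 ^ t * 4 ^ t * K ^ t    ≡⟨ cong (_* K ^ t) (sym ([m*n]^k≡m^k*n^k 4 4 t)) ⟩
  16 ^ t * K ^ t           ≡⟨ sym ([m*n]^k≡m^k*n^k 16 K t) ⟩
  (16 * K) ^ t             ≤⟨ threshold ⟩
  n * m ^ t                ≡⟨ *-comm n (m ^ t) ⟩
  m ^ t * n                ≤⟨ dense ⟩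
  m′ * Q                   ∎)))
  where
  open ≤-Reasoning
  Q : ℕ
  Q = 4 ^ t * K ^ t

-- Complete partite subgraphs

-- Extend x to a transversal by arbitrary vertices of the other (nonempty) parts.
on-some-edge : ∀ {n k} (F : Hyp n) t (Vs : Vec (Subset n) k) → GoodPartite F t Vs → 1 ≤ t →
  ∀ i {x} → x ∈ lookup Vs i → ∃[ y ] F y ≡ true × x ∈ y
on-some-edge F t Vs (_ , large , complete) 1≤t i {x} x∈Vᵢ = image f , complete f f∈V , subst (_∈ image f) fi≡x (∈-image⁺ f i)
  where
  f : Fin _ → Fin _
  f i′ with i′ ≟ᶠ i
  ... | yes _ = x
  ... | no _ = proj₁ (nonempty-of-size (lookup Vs i′) (≤-trans 1≤t (large i′)))
  f∈V : ∀ i′ → f i′ ∈ lookup Vs i′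
  f∈V i′ with i′ ≟ᶠ i
  ... | yes refl = x∈Vᵢ
  ... | no _ = proj₂ (nonempty-of-size (lookup Vs i′) (≤-trans 1≤t (large i′)))
  fi≡x : f i ≡ x
  fi≡x with i ≟ᶠ i
  ... | yes _ = refl
  ... | no i≢i = contradiction refl i≢i

GoodPartite-mono : ∀ {n k} {E : Hyp n} {t t′} {Vs : Vec (Subset n) k} → t ≤ t′ → GoodPartite E t′ Vs → GoodPartite E t Vs
GoodPartite-mono t≤t′ (disjoint , large , complete) = disjoint , (λ i → ≤-trans t≤t′ (large i)) , complete

GoodPartite-∷ʳ : ∀ {n} r (E : Hyp n) → Uniform (2 + r) E → ∀ T t (out : Vec (Subset n) (suc r)) →
  1 ≤ t → t ≤ ∣ T ∣ → GoodPartite (Slink (2 + r) E T) t out → GoodPartite E t (out ∷ʳ T)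
GoodPartite-∷ʳ {n} r E uniform T t out 1≤t t≤∣T∣ good@(disjoint , large , complete) = disjoint′ , large′ , complete′
  where
  Vs : Vec (Subset n) (2 + r)
  Vs = out ∷ʳ T
  part : ∀ i → lookup Vs (inject₁ i) ≡ lookup out i
  part = lookup-∷ʳ-inject₁ out T
  last : lookup Vs (fromℕ (suc r)) ≡ T
  last = lookup-∷ʳ-last out T
  T-apart : ∀ i x → x ∈ lookup out i → x ∉ T
  T-apart i x x∈Vᵢ x∈T with on-some-edge (Slink (2 + r) E T) t out good 1≤t i x∈Vᵢ
  ... | y , y∈S , x∈y = Slink-avoids r E uniform T y x∈T y∈S x∈y
  disjoint′ : ∀ i i′ → i ≢ i′ → ∀ x → x ∈ lookup Vs i → x ∈ lookup Vs i′ → ⊥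
  disjoint′ i i′ i≢i′ x x∈i x∈i′ with inject₁-or-last i | inject₁-or-last i′
  ... | inj₁ (a , refl) | inj₁ (b , refl) =
    disjoint a b (i≢i′ ∘ cong inject₁) x (subst (x ∈_) (part a) x∈i) (subst (x ∈_) (part b) x∈i′)
  ... | inj₁ (a , refl) | inj₂ refl = T-apart a x (subst (x ∈_) (part a) x∈i) (subst (x ∈_) last x∈i′)
  ... | inj₂ refl | inj₁ (b , refl) = T-apart b x (subst (x ∈_) (part b) x∈i′) (subst (x ∈_) last x∈i)
  ... | inj₂ refl | inj₂ refl = i≢i′ refl
  large′ : ∀ i → t ≤ ∣ lookup Vs i ∣
  large′ i with inject₁-or-last i
  ... | inj₁ (a , refl) = subst (λ s → t ≤ ∣ s ∣) (sym (part a)) (large a)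
  ... | inj₂ refl = subst (λ s → t ≤ ∣ s ∣) (sym last) t≤∣T∣
  complete′ : ∀ f → (∀ i → f i ∈ lookup Vs i) → E (image f) ≡ true
  complete′ f f∈Vs = subst (λ s → E s ≡ true) (sym (image-last f))
    (Slink-edge (2 + r) E T (image (f ∘ inject₁)) (subst (f (fromℕ (suc r)) ∈_) last (f∈Vs (fromℕ (suc r))))
      (complete (f ∘ inject₁) (λ i → subst (f (inject₁ i) ∈_) (part i) (f∈Vs (inject₁ i)))))

singletons-GoodPartite : ∀ {n} (E : Hyp n) → Uniform 1 E → ∀ t → t ≤ edges E →
  GoodPartite E t (tabulate (λ x → E ⁅ x ⁆) ∷ [])
singletons-GoodPartite {n} E uniform t t≤m = disjoint , large , complete
  where
  V : Vec (Subset n) 1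
  V = tabulate (λ x → E ⁅ x ⁆) ∷ []
  disjoint : ∀ i i′ → i ≢ i′ → ∀ x → x ∈ lookup V i → x ∈ lookup V i′ → ⊥
  disjoint zero zero 0≢0 _ _ _ = 0≢0 refl
  large : ∀ i → t ≤ ∣ lookup V i ∣
  large zero = ≤-trans t≤m (edges≤∣singletons∣ E uniform)
  complete : ∀ f → (∀ i → f i ∈ lookup V i) → E (image f) ≡ true
  complete f f∈V = trans (cong E (image-1 f)) (trans (sym (lookup∘tabulate (λ x → E ⁅ x ⁆) (f zero))) ([]=⇒lookup (f∈V zero)))

Admissible : ∀ {n} → ℕ → Hyp n → ℕ → Set
Admissible zero E t = ⊥
Admissible (suc zero) E t = 1 ≤ t × t ≤ edges E
Admissible {n} (suc (suc r)) E t = 2 ≤ t × t ≤ tval n (edges E) (2 + r)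

module Step {n : ℕ} (r : ℕ) (E : Hyp n) (uniform : Uniform (2 + r) E) (u : ℕ)
  (tval≡1+u : tval n (edges E) (2 + r) ≡ suc u) (2≤1+u : 2 ≤ suc u) where

  private
    m : ℕ
    m = edges E
    t : ℕ
    t = suc u
    K : ℕ
    K = n choose (2 + r)

    threshold-holds : tCond n m (2 + r) t ≡ true
    threshold-holds = subst (λ t′ → tCond n m (2 + r) t′ ≡ true) tval≡1+u
      (tSearch-sound n m (2 + r) n (subst (1 ≤_) (sym tval≡1+u) (s≤s z≤n)))

    m>0 : 0 < m
    m>0 = proj₁ (tCond-sound n m (2 + r) t threshold-holds)

    threshold : (16 * K) ^ (t ^ suc r) ≤ n * m ^ (t ^ suc r)
    threshold = proj₂ (tCond-sound n m (2 + r) t threshold-holds)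

    m≤K : m ≤ K
    m≤K = edges≤choose (2 + r) E uniform

    open ThresholdBounds n m r t K 2≤1+u m≤K m>0 threshold

    K>0 : 0 < K
    K>0 = ≤-trans m>0 m≤K

    denominator : ℕ
    denominator = 4 ^ t * K ^ t

    denominator>0 : 0 < denominator
    denominator>0 = *-mono-≤ (0<^ t (s≤s z≤n)) (0<^ t K>0)

    sval≡ : sval n m (2 + r) ≡ ceilDiv (m ^ t * (n choose suc r)) denominator
    sval≡ = trans (cong₂ (λ a b → ceilDiv (m ^ tval n m (2 + r) * a) (4 ^ tval n m (2 + r) * b ^ tval n m (2 + r)))
                         (C≡choose n (suc r)) (C≡choose n (2 + r)))
                  (cong (λ z → ceilDiv (m ^ z * (n choose suc r)) (4 ^ z * K ^ z)) tval≡1+u)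

    wval≡ : wval n m (2 + r) ≡ ceilDiv (4 * t * K) m
    wval≡ = trans (cong (λ b → ceilDiv (4 * tval n m (2 + r) * b) m) (C≡choose n (2 + r)))
                  (cong (λ z → ceilDiv (4 * z * K) m) tval≡1+u)

  chosen-exists : ∀ W → AdmW (2 + r) E W → Σ (Subset n) (Chosen (2 + r) E W)
  chosen-exists W (∣W∣≡w⊓n , top) = T , T⊆W , ∣T∣≡t , s≤edges
    where
    top′ : ∀ x y → lookup W x ≡ true → lookup W y ≡ false → deg E y ≤ deg E x
    top′ x y x∈W y∉W = top x y (lookup⇒[]= x W x∈W) (λ y∈W → true≢false (trans (sym ([]=⇒lookup y∈W)) y∉W))
      where
      true≢false : true ≢ false
      true≢false ()
    W-large : 4 * t * K ≤ ∣ W ∣ * m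
    W-large with ≤-total (wval n m (2 + r)) n
    ... | inj₁ w≤n = subst (λ z → 4 * t * K ≤ z * m) (sym (trans ∣W∣≡w⊓n (trans (m≤n⇒m⊓n≡m w≤n) wval≡)))
                       (a≤ceilDiv[a,b]*b (4 * t * K) m m>0)
    ... | inj₂ n≤w = subst (λ z → 4 * t * K ≤ z * m) (sym (trans ∣W∣≡w⊓n (m≥n⇒m⊓n≡n n≤w))) 4*t*K≤n*m
    found : ∃[ T ] (T ⊆ᵇ W ∧ (∣ T ∣ ≡ᵇ suc u) ≡ true) × ((n choose suc r) * edges E ^ suc u ≤ edges (Slink (2 + r) E T) * (4 * (n choose (2 + r))) ^ suc u)
    found = DenseLink.dense-link r E uniform W u top′ W-large 2*[1+r]≤n m>0
    T : Subset n
    T = proj₁ found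
    T⊆ᵇW∧∣T∣≡ᵇt : T ⊆ᵇ W ∧ (∣ T ∣ ≡ᵇ suc u) ≡ true
    T⊆ᵇW∧∣T∣≡ᵇt = proj₁ (proj₂ found)
    T⊆W : T ⊆ W
    T⊆W {x} x∈T = lookup⇒[]= x W (⊆ᵇ-sound T W x (∧-true-left _ _ T⊆ᵇW∧∣T∣≡ᵇt) ([]=⇒lookup x∈T))
    ∣T∣≡t : ∣ T ∣ ≡ tval n m (2 + r)
    ∣T∣≡t = trans (≡ᵇ-sound _ _ (∧-true-right _ _ T⊆ᵇW∧∣T∣≡ᵇt)) (sym tval≡1+u)
    s≤edges : sval n m (2 + r) ≤ edges (Slink (2 + r) E T)
    s≤edges = subst (_≤ edges (Slink (2 + r) E T)) (sym sval≡)
      (ceilDiv-least _ denominator _ denominator>0 (begin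
        m ^ t * (n choose suc r)                  ≡⟨ *-comm (m ^ t) _ ⟩
        (n choose suc r) * m ^ t                  ≤⟨ proj₂ (proj₂ found) ⟩
        edges (Slink (2 + r) E T) * (4 * K) ^ t   ≡⟨ cong (edges (Slink (2 + r) E T) *_) ([m*n]^k≡m^k*n^k 4 K t) ⟩
        edges (Slink (2 + r) E T) * denominator   ∎))
      where open ≤-Reasoning

  Slink-uniform : ∀ T → Uniform (suc r) (Slink (2 + r) E T)
  Slink-uniform T y = Slink-size (2 + r) E T y

  Slink-admissible : ∀ W T → Chosen (2 + r) E W T → Admissible (suc r) (Slink (2 + r) E T) t
  Slink-admissible W T (_ , _ , s≤m′) = admissible r refl
    where
    m′ : ℕ
    m′ = edges (Slink (2 + r) E T)
    dense : m ^ t * (n choose suc r) ≤ m′ * denominator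
    dense = ≤-trans (a≤ceilDiv[a,b]*b _ denominator denominator>0)
                    (*-monoˡ-≤ denominator (subst (_≤ m′) sval≡ s≤m′))
    m′>0 : 0 < m′
    m′>0 = 0<m*n⇒0<m (≤-trans (*-mono-≤ (0<^ t m>0) (0<choose (≤-trans (m≤m+n (suc r) (suc r + 0)) 2*[1+r]≤n))) dense)
    admissible : ∀ r′ → r′ ≡ r → Admissible (suc r′) (Slink (2 + r) E T) t
    admissible zero refl = s≤s z≤n , threshold-link₁ n m m′ K t K>0
      (subst (λ e → (16 * K) ^ e ≤ n * m ^ e) (*-identityʳ t) threshold)
      (subst (λ z → m ^ t * z ≤ m′ * denominator) (choose-1 n) dense)
    admissible (suc r′) refl = 2≤1+u , tSearch-greatest n m′ (2 + r′) n t
      (tCond-complete n m′ (2 + r′) t m′>0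
        (threshold-link n m m′ K (n choose (2 + r′)) t (t ^ suc r′) K>0 2≤1+u threshold dense)) t≤n

FindPartiteSpec : ∀ {n} → ℕ → Hyp n → ℕ → Set
FindPartiteSpec {n} j E t = Succeeds j E × ((out : Vec (Subset n) j) → Run j E out → GoodPartite E t out)

FindPartite-step : ∀ {n} r →
  (∀ (E′ : Hyp n) → Uniform (suc r) E′ → ∀ t → Admissible (suc r) E′ t → FindPartiteSpec (suc r) E′ t) →
  ∀ (E : Hyp n) → Uniform (2 + r) E → ∀ t → Admissible (2 + r) E t → FindPartiteSpec (2 + r) E t
FindPartite-step {n} r correct E uniform t (2≤t , t≤tval) = succeeds , runs-good
  where
  u : ℕ
  u = pred (tval n (edges E) (2 + r))
  tval≡1+u : tval n (edges E) (2 + r) ≡ suc u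
  tval≡1+u = sym (suc-pred _ {{>-nonZero (≤-trans (s≤s z≤n) (≤-trans 2≤t t≤tval))}})
  open Step r E uniform u tval≡1+u (subst (2 ≤_) tval≡1+u (≤-trans 2≤t t≤tval))
  recurse : ∀ W T → Chosen (2 + r) E W T → FindPartiteSpec (suc r) (Slink (2 + r) E T) (suc u)
  recurse W T chosen = correct (Slink (2 + r) E T) (Slink-uniform T) (suc u) (Slink-admissible W T chosen)
  succeeds : Succeeds (2 + r) E
  succeeds = chosen-exists , λ W T _ chosen → proj₁ (recurse W T chosen)
  runs-good : (out : Vec (Subset n) (2 + r)) → Run (2 + r) E out → GoodPartite E t out
  runs-good _ (step {W = W} {T} {out} _ chosen@(_ , ∣T∣≡tval , _) run) =
    GoodPartite-mono {E = E} {Vs = out ∷ʳ T} (subst (t ≤_) tval≡1+u t≤tval)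
      (GoodPartite-∷ʳ r E uniform T (suc u) out (s≤s z≤n) (≤-reflexive (sym (trans ∣T∣≡tval tval≡1+u)))
        (proj₂ (recurse W T chosen) out run))

FindPartite-correct : ∀ {n} j (E : Hyp n) → Uniform j E → ∀ t → Admissible j E t → FindPartiteSpec j E t
FindPartite-correct (suc zero) E uniform t (_ , t≤m) = tt , λ { _ base → singletons-GoodPartite E uniform t t≤m }
FindPartite-correct (suc (suc r)) = FindPartite-step r (FindPartite-correct (suc r))

theorem3p2 : (n k : ℕ) → 2 ≤ k → (E : Hyp n) → Uniform k E →
    2 ≤ tval n (edges E) k →
    Succeeds k E ×
    ((out : Vec (Subset n) k) → Run k E out → GoodPartite E (tval n (edges E) k) out)
theorem3p2 n (suc (suc r)) (s≤s (s≤s z≤n)) E uniform 2≤t = FindPartite-correct (2 + r) E uniform _ (2≤t , ≤-refl)
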